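{- Let $\varphi$ be an instance of \textsc{$q$-CSP-6} with variables $x_1,\dots,x_n$ and constraints $c_0,\dots,c_{m-1}$, and let $G$ and $k$ be constructed from $\varphi$ as described in the context. If $G$ has an upper dominating set of size at least $k$, then $\varphi$ is satisfiable.
   Context: \textsc{$q$-CSP-6}: variables $x_1,\dots,x_n$ take values in $\{0,1,2,3,4,5\}$; each constraint $c_j$ ($0\le j\le m-1$) involves exactly $q$ variables and is given as a list of $C_j$ acceptable assignments $\sigma_1,\dots,\sigma_{C_j}$ of values to its $q$ variables; $\varphi$ is satisfiable if some assignment of all variables restricts to an acceptable assignment of every constraint. Construction: set $A=4q+2$, $F=(2n+1)(4n+1)$, $k=Fm(2n+A)+2n$. (1) For each $i\in\{1,\dots,n\}$ build a path $P_i$ on vertices $u_{i,j}$, $j\in\{ -3,\dots,4Fm+2\}$, with edges $u_{i,j}u_{i,j+1}$. (2) For each $j\in\{0,\dots,Fm-1\}$, with $j'=j\bmod m$, build a gadget $H_j$: a clique $K_j$ on $AC_{j'}$ vertices partitioned into $C_{j'}$ sets $K_j^1,\dots,K_j^{C_{j'}}$ of size $A$ ($K_j^l$ corresponds to $\sigma_l$ in the list of $c_{j'}$); a clique $L_j$ on $AC_{j'}$ vertices partitioned into sets $L_j^1,\dots,L_j^{C_{j'}}$ of size $A$. For each variable $x_i$ involved in $c_{j'}$ and each $l$, if $\sigma_l$ gives $x_i$ value $v$, connect both vertices of the pair $p_v$ to all $A$ vertices of $K_j^l$, where $p_0=\{u_{i,4j+2},u_{i,4j+3}\}$, $p_1=\{u_{i,4j+3},u_{i,4j}\}$,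 $p_2=\{u_{i,4j},u_{i,4j+1}\}$, $p_3=\{u_{i,4j+1},u_{i,4j+2}\}$, $p_4=\{u_{i,4j+1},u_{i,4j+3}\}$, $p_5=\{u_{i,4j},u_{i,4j+2}\}$. For each $l$, add a perfect matching between $K_j^l$ and $L_j^l$, and all edges between $K_j^l$ and $L_j^{l'}$ for every $l'\ne l$. Add a vertex $w_j$ adjacent to all vertices of $L_j$. A set $D$ of vertices is dominating if every vertex is in $D$ or adjacent to a vertex of $D$; an upper dominating set is an inclusion-minimal dominating set. -}

module Defs where

open import Data.Nat using (ℕ; _+_; _*_; _≤_)
import Data.Nat as ℕ
open import Data.Fin using (Fin; toℕ; remainder; zero; suc)
open import Data.Product using (Σ; _×_; _,_; ∃; ∃-syntax; proj₁; proj₂)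
open import Data.Sum using (_⊎_)
open import Data.List using (List; length)
open import Data.List.Membership.Propositional using (_∈_)
open import Data.List.Relation.Unary.Unique.Propositional using (Unique)
open import Relation.Nullary using (¬_)
open import Relation.Binary.PropositionalEquality using (_≡_)
open import Function.Definitions using (Injective)

-- An instance of q-CSP-6 with n variables (x_1..x_n indexed by Fin n, x_{i+1} ↔ i)
-- and m constraints c_0..c_{m-1} (indexed by Fin m).
record CSP6 (q n m : ℕ) : Set where
  field
    scope     : Fin m → Fin q → Fin n
    scope-inj : ∀ j → Injective _≡_ _≡_ (scope j)
    -- number C_j of acceptable assignments of constraint j
    C         : Fin m → ℕ
    -- the l-th acceptable assignment σ_l: value given to the s-th variable of c_j
    acc       : (j : Fin m) → Fin (C j) → Fin q → Fin 6

Satisfiable : ∀ {q n m} → CSP6 q n m → Set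
Satisfiable {q} {n} {m} φ =
  Σ (Fin n → Fin 6) λ x →
    (j : Fin m) → Σ (Fin (C j)) λ l → (s : Fin q) → x (scope j s) ≡ acc j l s
  where open CSP6 φ

Aof : ℕ → ℕ
Aof q = 4 * q + 2

Fof : ℕ → ℕ
Fof n = (2 * n + 1) * (4 * n + 1)

kOf : ℕ → ℕ → ℕ → ℕ
kOf q n m = Fof n * m * (2 * n + Aof q) + 2 * n

-- The pair p_v as offsets a ∈ {0,1,2,3} (meaning vertex u_{i,4j+a}).
pairOf : Fin 6 → ℕ × ℕ
pairOf zero = 2 , 3
pairOf (suc zero) = 3 , 0
pairOf (suc (suc zero)) = 0 , 1
pairOf (suc (suc (suc zero))) = 1 , 2
pairOf (suc (suc (suc (suc zero)))) = 1 , 3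
pairOf (suc (suc (suc (suc (suc zero))))) = 0 , 2

InPair : Fin 6 → ℕ → Set
InPair v a = a ≡ proj₁ (pairOf v) ⊎ a ≡ proj₂ (pairOf v)

module Construction {q n m : ℕ} (φ : CSP6 q n m) where
  open CSP6 φ

  A F k : ℕ
  A = Aof q
  F = Fof n
  k = kOf q n m

  -- j' = j mod m  (Data.Fin.remainder: toℕ (remainder m j) ≡ toℕ j mod m)
  j′ : Fin (F * m) → Fin m
  j′ j = remainder {F} m j

  data V : Set where
    -- u i t  is  u_{i+1, t-3}   (t ∈ {0,…,4Fm+5}, i.e. path index j ∈ {-3,…,4Fm+2})
    u  : Fin n → Fin (4 * F * m + 6) → V
    -- kv j l a : the a-th vertex of K_j^{l+1};  lv j l a : the a-th vertex of L_j^{l+1}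
    kv : (j : Fin (F * m)) → Fin (C (j′ j)) → Fin A → V
    lv : (j : Fin (F * m)) → Fin (C (j′ j)) → Fin A → V
    w  : Fin (F * m) → V

  data E : V → V → Set where
    path  : ∀ i t t′ → toℕ t′ ≡ ℕ.suc (toℕ t) → E (u i t) (u i t′)
    Kcl   : ∀ j l a l′ a′ → ¬ (l ≡ l′ × a ≡ a′) → E (kv j l a) (kv j l′ a′)
    Lcl   : ∀ j l a l′ a′ → ¬ (l ≡ l′ × a ≡ a′) → E (lv j l a) (lv j l′ a′)
    -- x_i = scope j' s is involved in c_{j'}; σ_l gives it value v = acc j' l s;
    -- both vertices of p_v (on path P_i) are joined to all of K_j^l
    pair  : ∀ j l a (s : Fin q) t o → InPair (acc (j′ j) l s) o →
            toℕ t ≡ 4 * toℕ j + o + 3 →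
            E (u (scope (j′ j) s) t) (kv j l a)
    match : ∀ j l a → E (kv j l a) (lv j l a)
    KL    : ∀ j l a l′ a′ → ¬ (l ≡ l′) → E (kv j l a) (lv j l′ a′)
    wL    : ∀ j l a → E (w j) (lv j l a)

  Adj : V → V → Set
  Adj x y = E x y ⊎ E y x

  -- vertex sets are duplicate-free lists; size = length
  Dominating : List V → Set
  Dominating D = ∀ v → v ∈ D ⊎ ∃[ x ] (x ∈ D × Adj x v)

  -- upper dominating set = inclusion-minimal dominating set
  UpperDominating : List V → Set
  UpperDominating D =
    Unique D × Dominating D ×
    (∀ (D′ : List V) → (∀ x → x ∈ D′ → x ∈ D) → Dominating D′ → ∀ x → x ∈ D → x ∈ D′)

-- Let D be a minimal dominating set with |D| ≥ k. Two local budgets are charged against |D|. On a path P_i, a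
-- potential on windows of eight consecutive path vertices (found by computer search, checked here exhaustively)
-- telescopes to 6|D ∩ P_i| + (penalties on P_i) ≤ 3 (path vertices of D all of whose private neighbours lie
-- in clause gadgets) + 12(F·m + 2). In a gadget H_j, a case analysis of private neighbours gives
-- 2|D ∩ H_j| + (such path vertices at block j) + bad_j ≤ 2A. Summing, |D| ≥ k leaves
-- (all penalties) + (all bad_j) ≤ 12n < F, so one of the F copies of c_0, …, c_{m-1} is entirely penalty- and
-- bad-free. There every block of four path vertices meets D in exactly two vertices, the blocks of a path agree,
-- and every clause has an assignment σ_l avoiding D on its pairs p_v; reading each block's complement of D as
-- the pair p_v of a value v gives a satisfying assignment.

module Submission where

open import Defs
open import Data.Nat using (ℕ; _≤_)
open import Data.List using (List; length)
open import Data.Product using (Σ; _×_)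

open import Data.Bool using (Bool; true; false; _∧_; _∨_; not; T)
open import Data.Bool.Properties using (T-∧) renaming (_≟_ to _≟ᵇ_)
import Data.Bool.Properties as Boolₚ
open import Data.Nat
open import Data.Nat.Properties
open import Data.Nat.Solver using (module +-*-Solver)
open +-*-Solver using (solve; _:+_; _:*_; _:=_; con)
open import Algebra.Properties.CommutativeSemigroup +-commutativeSemigroup using (interchange)
open import Algebra.Properties.Semiring.Sum +-*-semiring using (sum; sum-cong-≗; ∑-distrib-+; ∑-comm; *-distribˡ-sum)
open import Data.Empty using (⊥)
open import Data.Fin using (Fin; toℕ; fromℕ<; zero; suc; combine; _↑ˡ_; _↑ʳ_)
import Data.Fin.Properties as Finₚ
open import Data.Vec using (Vec; []; _∷_; lookup)
open import Data.Product using (∃-syntax; _,_; proj₁; proj₂)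
open import Data.Product.Properties using (≡-dec)
open import Data.Sum using (_⊎_; inj₁; inj₂; [_,_]′)
import Data.Sum.Properties as Sumₚ
open import Data.List using ([]; _∷_; _++_; filter)
open import Data.List.Relation.Unary.Any using (here; there)
open import Data.List.Relation.Unary.Unique.Propositional using (Unique)
open import Data.List.Relation.Unary.AllPairs using (_∷_)
import Data.List.Relation.Unary.All as All
open import Data.List.Membership.Propositional using (_∈_)
open import Data.List.Membership.Propositional.Properties using (∈-filter⁺; ∈-filter⁻; ∈-++⁺ˡ; ∈-++⁺ʳ)
open import Function using (_∘_)
open import Function.Bundles using (Equivalence)
open import Relation.Binary.Definitions using (DecidableEquality; tri<; tri≈; tri>)
open import Relation.Binary.PropositionalEquality hiding (J)
open import Relation.Nullary using (¬_; Dec; yes; no; does; ¬?; _×-dec_; _→-dec_; contradiction)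
open import Relation.Nullary.Negation using (DoubleNegation)
open import Relation.Nullary.Decidable using (toWitness; ⌊_⌋; map′; decidable-stable; dec-true; dec-false; _⊎-dec_)


-- Finite sums

bit : Bool → ℕ
bit true = 1
bit false = 0

bit≤1 : ∀ b → bit b ≤ 1
bit≤1 true = ≤-refl
bit≤1 false = z≤n

bit≤ : ∀ b {x} → (b ≡ true → 1 ≤ x) → bit b ≤ x
bit≤ true pos = pos refl
bit≤ false _ = z≤n

bit≡1⇒true : ∀ {b} → bit b ≡ 1 → b ≡ true
bit≡1⇒true {true} _ = refl

bit≡0⇒false : ∀ {b} → bit b ≡ 0 → b ≡ false
bit≡0⇒false {false} _ = refl

does≡true : ∀ {P : Set} (p? : Dec P) → does p? ≡ true → P
does≡true (yes p) _ = p

bit-does≡1 : ∀ {P : Set} (p? : Dec P) → bit (does p?) ≡ 1 → P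
bit-does≡1 (yes p) _ = p

bit-not-does≡0 : ∀ {P : Set} (p? : Dec P) → bit (not (does p?)) ≡ 0 → P
bit-not-does≡0 (yes p) _ = p

sumTo : ℕ → (ℕ → ℕ) → ℕ
sumTo N f = sum {N} (f ∘ toℕ)

δ : ∀ {n} → Fin n → Fin n → ℕ
δ x y = bit (does (x Finₚ.≟ y))

δ-refl : ∀ {n} (x : Fin n) → δ x x ≡ 1
δ-refl x with x Finₚ.≟ x
... | yes _ = refl
... | no x≢x = contradiction refl x≢x

sum-mono : ∀ {n} {f g : Fin n → ℕ} → (∀ i → f i ≤ g i) → sum f ≤ sum g
sum-mono {zero} _ = z≤n
sum-mono {suc _} f≤g = +-mono-≤ (f≤g zero) (sum-mono (f≤g ∘ suc))

sum-const : ∀ n c → sum {n} (λ _ → c) ≡ n * c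
sum-const zero c = refl
sum-const (suc n) c = cong (c +_) (sum-const n c)

sum-zero : ∀ {n} (f : Fin n → ℕ) → (∀ i → f i ≡ 0) → sum f ≡ 0
sum-zero {n} f f≡0 = trans (sum-cong-≗ f≡0) (trans (sum-const n 0) (*-zeroʳ n))

term≤sum : ∀ {n} (f : Fin n → ℕ) i → f i ≤ sum f
term≤sum f zero = m≤m+n _ _
term≤sum f (suc i) = ≤-trans (term≤sum (f ∘ suc) i) (m≤n+m _ (f zero))

sum≡0⇒term≡0 : ∀ {n} (f : Fin n → ℕ) → sum f ≡ 0 → ∀ i → f i ≡ 0
sum≡0⇒term≡0 f ∑f≡0 i = n≤0⇒n≡0 (≤-trans (term≤sum f i) (≤-reflexive ∑f≡0))

sum-pos : ∀ {n} (f : Fin n → ℕ) → 1 ≤ sum f → Σ (Fin n) λ i → 1 ≤ f i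
sum-pos {suc n} f pos with f zero in eq
... | suc _ = zero , ≤-trans (s≤s z≤n) (≤-reflexive (sym eq))
... | zero with sum-pos (f ∘ suc) pos
...   | i , p = suc i , p

sum-δ : ∀ {n} (x : Fin n) → sum (δ x) ≡ 1
sum-δ {suc n} zero = cong suc (sum-zero {n} (δ zero ∘ suc) λ _ → refl)
sum-δ {suc n} (suc x) = trans (sum-cong-≗ δ-suc) (sum-δ x)
  where
  δ-suc : ∀ y → δ (suc x) (suc y) ≡ δ x y
  δ-suc y with x Finₚ.≟ y
  ... | yes refl = refl
  ... | no _ = refl

sum≤card : ∀ {n} (f : Fin n → ℕ) → (∀ i → f i ≤ 1) → sum f ≤ n
sum≤card {n} f f≤1 = ≤-trans (sum-mono f≤1) (≤-reflexive (trans (sum-const n 1) (*-identityʳ n)))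

sum-single : ∀ {n} (f : Fin n → ℕ) x → (∀ y → x ≢ y → f y ≡ 0) → sum f ≡ f x
sum-single f x vanish = ≤-antisym (≤-trans (sum-mono bound) (≤-reflexive collapse)) (term≤sum f x)
  where
  bound : ∀ y → f y ≤ f x * δ x y
  bound y with x Finₚ.≟ y
  ... | yes refl = ≤-reflexive (sym (*-identityʳ (f y)))
  ... | no x≢y = ≤-reflexive (trans (vanish y x≢y) (sym (*-zeroʳ (f x))))
  collapse : sum (λ y → f x * δ x y) ≡ f x
  collapse = trans (sym (*-distribˡ-sum (f x) (δ x))) (trans (cong (f x *_) (sum-δ x)) (*-identityʳ (f x)))

sum<card : ∀ {n} (f : Fin n → ℕ) x → (∀ y → f y ≤ 1) → f x ≡ 0 → sum f < n
sum<card f x f≤1 fx≡0 = begin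
    suc (sum f)        ≡⟨ +-comm 1 (sum f) ⟩
    sum f + 1          ≡⟨ cong (sum f +_) (sum-δ x) ⟨
    sum f + sum (δ x)  ≡⟨ ∑-distrib-+ f (δ x) ⟨
    sum (λ y → f y + δ x y) ≤⟨ sum≤card _ bound ⟩
    _ ∎
  where
  open ≤-Reasoning
  bound : ∀ y → f y + δ x y ≤ 1
  bound y with x Finₚ.≟ y
  ... | yes refl rewrite fx≡0 = ≤-refl
  ... | no _ = ≤-trans (≤-reflexive (+-identityʳ (f y))) (f≤1 y)

sum≤1 : ∀ {n} (f : Fin n → ℕ) → (∀ i → f i ≤ 1) → (∀ i j → f i ≡ 1 → f j ≡ 1 → i ≡ j) → sum f ≤ 1
sum≤1 {zero} f _ _ = z≤n
sum≤1 {suc n} f f≤1 unique with f zero in eq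
... | zero = sum≤1 (f ∘ suc) (f≤1 ∘ suc) λ i j fi fj → Finₚ.suc-injective (unique (suc i) (suc j) fi fj)
... | suc zero = ≤-reflexive (cong suc (sum-zero (f ∘ suc) rest))
  where
  rest : ∀ i → f (suc i) ≡ 0
  rest i with f (suc i) in eqᵢ | f≤1 (suc i)
  ... | zero | _ = refl
  ... | suc zero | _ with () ← unique zero (suc i) eq eqᵢ
  ... | suc (suc _) | s≤s ()
... | suc (suc _) with s≤s () ← ≤-trans (≤-reflexive (sym eq)) (f≤1 zero)

sum²≤1 : ∀ {n k} (f : Fin n → Fin k → ℕ) → (∀ i j → f i j ≤ 1) →
         (∀ i j i′ j′ → f i j ≡ 1 → f i′ j′ ≡ 1 → i ≡ i′ × j ≡ j′) → sum (λ i → sum (f i)) ≤ 1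
sum²≤1 f f≤1 unique = sum≤1 _ rows≤1 rowsUnique
  where
  rows≤1 : ∀ i → sum (f i) ≤ 1
  rows≤1 i = sum≤1 (f i) (f≤1 i) λ j j′ p p′ → proj₂ (unique i j i j′ p p′)
  one : ∀ i j → 1 ≤ f i j → f i j ≡ 1
  one i j pos = ≤-antisym (f≤1 i j) pos
  rowsUnique : ∀ i i′ → sum (f i) ≡ 1 → sum (f i′) ≡ 1 → i ≡ i′
  rowsUnique i i′ p p′ with sum-pos (f i) (≤-reflexive (sym p)) | sum-pos (f i′) (≤-reflexive (sym p′))
  ... | j , q | j′ , q′ = proj₁ (unique i j i′ j′ (one i j q) (one i′ j′ q′))

sum-↑ : ∀ a b (h : Fin (a + b) → ℕ) → sum h ≡ sum (λ i → h (i ↑ˡ b)) + sum (λ i → h (a ↑ʳ i))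
sum-↑ zero b h = refl
sum-↑ (suc a) b h = trans (cong (h zero +_) (sum-↑ a b (h ∘ suc))) (sym (+-assoc (h zero) _ _))

sum-combine : ∀ k l (h : Fin (k * l) → ℕ) → sum h ≡ sum (λ c → sum (λ r → h (combine {k} {l} c r)))
sum-combine zero l h = refl
sum-combine (suc k) l h =
  trans (sum-↑ l (k * l) h) (cong (sum (λ r → h (r ↑ˡ (k * l))) +_) (sum-combine k l (λ i → h (l ↑ʳ i))))

pigeonhole : ∀ {n} (f : Fin n → ℕ) → sum f < n → Σ (Fin n) λ i → f i ≡ 0
pigeonhole {suc n} f ∑f<n with f zero in eq
... | zero = zero , eq
... | suc k with pigeonhole (f ∘ suc) (≤-trans (s≤s (m≤n+m _ k)) (≤-pred ∑f<n))
...   | i , fi≡0 = suc i , fi≡0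

sumTo-mono< : ∀ N {f g : ℕ → ℕ} → (∀ t → t < N → f t ≤ g t) → sumTo N f ≤ sumTo N g
sumTo-mono< N f≤g = sum-mono λ t → f≤g (toℕ t) (Finₚ.toℕ<n t)

sumTo-cong< : ∀ N {f g : ℕ → ℕ} → (∀ t → t < N → f t ≡ g t) → sumTo N f ≡ sumTo N g
sumTo-cong< N f≡g = sum-cong-≗ λ t → f≡g (toℕ t) (Finₚ.toℕ<n t)

sumTo-term : ∀ N (f : ℕ → ℕ) t → t < N → f t ≤ sumTo N f
sumTo-term (suc N) f zero _ = m≤m+n _ _
sumTo-term (suc N) f (suc t) (s≤s t<N) = ≤-trans (sumTo-term N (f ∘ suc) t t<N) (m≤n+m _ (f 0))

sumTo≡0⇒term≡0 : ∀ N (f : ℕ → ℕ) → sumTo N f ≡ 0 → ∀ t → t < N → f t ≡ 0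
sumTo≡0⇒term≡0 N f ∑f≡0 t t<N = n≤0⇒n≡0 (≤-trans (sumTo-term N f t t<N) (≤-reflexive ∑f≡0))

sumTo-split : ∀ a b (f : ℕ → ℕ) → sumTo (a + b) f ≡ sumTo a f + sumTo b (λ t → f (a + t))
sumTo-split zero b f = refl
sumTo-split (suc a) b f = trans (cong (f 0 +_) (sumTo-split a b (f ∘ suc))) (sym (+-assoc (f 0) _ _))

sumTo-last : ∀ N (f : ℕ → ℕ) → sumTo (suc N) f ≡ sumTo N f + f N
sumTo-last N f = begin
    sumTo (suc N) f              ≡⟨ cong (λ M → sumTo M f) (+-comm 1 N) ⟩
    sumTo (N + 1) f              ≡⟨ sumTo-split N 1 f ⟩
    sumTo N f + (f (N + 0) + 0)  ≡⟨ cong (sumTo N f +_) (trans (+-identityʳ _) (cong f (+-identityʳ N))) ⟩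
    sumTo N f + f N ∎
  where open ≡-Reasoning

sumTo-blocks : ∀ M (f : ℕ → ℕ) →
  sumTo (M * 4) f ≡ sumTo M (λ K → f (K * 4) + f (1 + K * 4) + f (2 + K * 4) + f (3 + K * 4))
sumTo-blocks zero f = refl
sumTo-blocks (suc M) f = begin
    f 0 + (f 1 + (f 2 + (f 3 + sumTo (M * 4) (λ t → f (4 + t)))))
      ≡⟨ regroup (f 0) (f 1) (f 2) (f 3) _ ⟩
    f 0 + f 1 + f 2 + f 3 + sumTo (M * 4) (λ t → f (4 + t))
      ≡⟨ cong (f 0 + f 1 + f 2 + f 3 +_) (sumTo-blocks M (λ t → f (4 + t))) ⟩
    _ ∎
  where
  open ≡-Reasoning
  regroup : ∀ a b c d x → a + (b + (c + (d + x))) ≡ a + b + c + d + x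
  regroup a b c d x = trans (sym (+-assoc a b _)) (trans (sym (+-assoc (a + b) c _)) (sym (+-assoc (a + b + c) d x)))

sumTo-+ : ∀ N (f g : ℕ → ℕ) → sumTo N (λ t → f t + g t) ≡ sumTo N f + sumTo N g
sumTo-+ N f g = ∑-distrib-+ {N} (f ∘ toℕ) (g ∘ toℕ)

sumTo-* : ∀ N c (f : ℕ → ℕ) → sumTo N (λ t → c * f t) ≡ c * sumTo N f
sumTo-* N c f = sym (*-distribˡ-sum {N} c (f ∘ toℕ))

sum²-δ : ∀ {n k} (x : Fin n) (y : Fin k) → sum (λ i → sum λ j → δ x i * δ y j) ≡ 1
sum²-δ x y = trans (sum-cong-≗ row) (sum-δ x)
  where
  row : ∀ i → sum (λ j → δ x i * δ y j) ≡ δ x i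
  row i = trans (sym (*-distribˡ-sum (δ x i) (δ y))) (trans (cong (δ x i *_) (sum-δ y)) (*-identityʳ (δ x i)))

-- Boolean windows and the potential certificate

allBits : ∀ n → (Vec Bool n → Bool) → Bool
allBits zero f = f []
allBits (suc n) f = allBits n (f ∘ (true ∷_)) ∧ allBits n (f ∘ (false ∷_))

allBits-sound : ∀ n f → T (allBits n f) → ∀ v → T (f v)
allBits-sound zero f ok [] = ok
allBits-sound (suc n) f ok (true ∷ v) = allBits-sound n _ (proj₁ (Equivalence.to T-∧ ok)) v
allBits-sound (suc n) f ok (false ∷ v) = allBits-sound n _ (proj₂ (Equivalence.to T-∧ ok)) v

-- Membership in D of five consecutive path vertices a b c d e: c ∈ D, yet none of c (needs b, d ∉ D),
-- b (needs a, b ∉ D) or d (needs d, e ∉ D) can be a private neighbour of c, so its private neighbours lie in clause gadgets.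
kPrivate : Bool → Bool → Bool → Bool → Bool → Bool
kPrivate a b c d e = c ∧ not ((not b ∧ not d) ∨ (not b ∧ not a) ∨ (not d ∧ not e))

kDominated : Bool → Bool → Bool → Bool
kDominated b c d = not b ∧ not c ∧ not d

kPrivate-elim : ∀ a b c d e → kPrivate a b c d e ≡ true →
  c ≡ true × (b ≡ true ⊎ d ≡ true) × (b ≡ true ⊎ a ≡ true) × (d ≡ true ⊎ e ≡ true)
kPrivate-elim a true true true e _ = refl , inj₁ refl , inj₁ refl , inj₁ refl
kPrivate-elim a true true false true _ = refl , inj₁ refl , inj₁ refl , inj₂ refl
kPrivate-elim true false true true e _ = refl , inj₂ refl , inj₂ refl , inj₁ refl

kDominated-elim : ∀ b c d → kDominated b c d ≡ true → b ≡ false × c ≡ false × d ≡ false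
kDominated-elim false false false _ = refl , refl , refl

usesK : Bool → Bool → Bool → Bool → Bool → Bool → Bool → Bool → Bool
usesK x₀ x₁ x₂ x₃ x₄ x₅ x₆ x₇ =
  kPrivate x₀ x₁ x₂ x₃ x₄ ∨ kPrivate x₁ x₂ x₃ x₄ x₅ ∨ kPrivate x₂ x₃ x₄ x₅ x₆ ∨ kPrivate x₃ x₄ x₅ x₆ x₇ ∨
  kDominated x₁ x₂ x₃ ∨ kDominated x₂ x₃ x₄ ∨ kDominated x₃ x₄ x₅ ∨ kDominated x₄ x₅ x₆

kPrivateCount : Bool → Bool → Bool → Bool → Bool → Bool → Bool → Bool → ℕ
kPrivateCount x₀ x₁ x₂ x₃ x₄ x₅ x₆ x₇ =
  bit (kPrivate x₀ x₁ x₂ x₃ x₄) + bit (kPrivate x₁ x₂ x₃ x₄ x₅) + bit (kPrivate x₂ x₃ x₄ x₅ x₆) + bit (kPrivate x₃ x₄ x₅ x₆ x₇)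

exactlyTwo : Bool → Bool → Bool → Bool → Bool
exactlyTwo a b c d = (bit a + bit b + bit c + bit d) ≡ᵇ 2

Block : Set
Block = Bool × Bool × Bool × Bool

_≟ᴮ_ : DecidableEquality Block
_≟ᴮ_ = ≡-dec _≟ᵇ_ (≡-dec _≟ᵇ_ (≡-dec _≟ᵇ_ _≟ᵇ_))

penalty : Bool → Bool → Bool → Bool → Bool → Bool → Bool → Bool → Bool → Bool → Bool → Bool → ℕ
penalty x₀ x₁ x₂ x₃ x₄ x₅ x₆ x₇ x₈ x₉ x₁₀ x₁₁ =
  bit (not (usesK x₄ x₅ x₆ x₇ x₈ x₉ x₁₀ x₁₁) ∧
       (not (exactlyTwo x₆ x₇ x₈ x₉) ∨
        (not (usesK x₀ x₁ x₂ x₃ x₄ x₅ x₆ x₇) ∧ not (does ((x₆ , x₇ , x₈ , x₉) ≟ᴮ (x₂ , x₃ , x₄ , x₅))))))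

-- Found by computer search; row index x₀x₁x₂x₃ and column index x₄x₅x₆x₇ read in binary.
potentialTable : Vec (Vec ℕ 16) 16
potentialTable =
  (3 ∷ 3 ∷ 4 ∷ 6 ∷ 0 ∷ 2 ∷ 3 ∷ 3 ∷ 3 ∷ 3 ∷ 4 ∷ 3 ∷ 0 ∷ 2 ∷ 3 ∷ 3 ∷ []) ∷
  (3 ∷ 3 ∷ 5 ∷ 7 ∷ 1 ∷ 2 ∷ 3 ∷ 3 ∷ 3 ∷ 3 ∷ 4 ∷ 3 ∷ 0 ∷ 2 ∷ 3 ∷ 3 ∷ []) ∷
  (3 ∷ 3 ∷ 4 ∷ 6 ∷ 1 ∷ 3 ∷ 3 ∷ 3 ∷ 3 ∷ 4 ∷ 4 ∷ 3 ∷ 0 ∷ 2 ∷ 3 ∷ 3 ∷ []) ∷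
  (3 ∷ 3 ∷ 5 ∷ 6 ∷ 0 ∷ 2 ∷ 3 ∷ 3 ∷ 3 ∷ 3 ∷ 4 ∷ 3 ∷ 0 ∷ 2 ∷ 3 ∷ 3 ∷ []) ∷
  (3 ∷ 3 ∷ 4 ∷ 6 ∷ 0 ∷ 2 ∷ 3 ∷ 3 ∷ 3 ∷ 4 ∷ 5 ∷ 3 ∷ 0 ∷ 2 ∷ 3 ∷ 3 ∷ []) ∷
  (3 ∷ 3 ∷ 5 ∷ 7 ∷ 1 ∷ 2 ∷ 3 ∷ 3 ∷ 3 ∷ 3 ∷ 4 ∷ 3 ∷ 0 ∷ 2 ∷ 3 ∷ 3 ∷ []) ∷
  (3 ∷ 3 ∷ 4 ∷ 6 ∷ 1 ∷ 3 ∷ 3 ∷ 3 ∷ 3 ∷ 3 ∷ 4 ∷ 3 ∷ 0 ∷ 2 ∷ 3 ∷ 3 ∷ []) ∷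
  (3 ∷ 3 ∷ 4 ∷ 6 ∷ 0 ∷ 2 ∷ 3 ∷ 3 ∷ 3 ∷ 3 ∷ 4 ∷ 3 ∷ 0 ∷ 2 ∷ 3 ∷ 3 ∷ []) ∷
  (3 ∷ 3 ∷ 4 ∷ 6 ∷ 0 ∷ 2 ∷ 3 ∷ 3 ∷ 3 ∷ 3 ∷ 4 ∷ 3 ∷ 0 ∷ 2 ∷ 3 ∷ 3 ∷ []) ∷
  (3 ∷ 3 ∷ 5 ∷ 7 ∷ 1 ∷ 2 ∷ 3 ∷ 3 ∷ 3 ∷ 3 ∷ 4 ∷ 3 ∷ 0 ∷ 2 ∷ 3 ∷ 3 ∷ []) ∷
  (3 ∷ 3 ∷ 4 ∷ 6 ∷ 1 ∷ 3 ∷ 3 ∷ 3 ∷ 3 ∷ 4 ∷ 4 ∷ 3 ∷ 0 ∷ 2 ∷ 3 ∷ 3 ∷ []) ∷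
  (3 ∷ 3 ∷ 4 ∷ 6 ∷ 0 ∷ 2 ∷ 3 ∷ 3 ∷ 3 ∷ 3 ∷ 4 ∷ 3 ∷ 0 ∷ 2 ∷ 3 ∷ 3 ∷ []) ∷
  (3 ∷ 3 ∷ 4 ∷ 6 ∷ 0 ∷ 2 ∷ 3 ∷ 3 ∷ 3 ∷ 4 ∷ 5 ∷ 3 ∷ 0 ∷ 2 ∷ 3 ∷ 3 ∷ []) ∷
  (3 ∷ 3 ∷ 5 ∷ 7 ∷ 1 ∷ 2 ∷ 3 ∷ 3 ∷ 3 ∷ 3 ∷ 4 ∷ 3 ∷ 0 ∷ 2 ∷ 3 ∷ 3 ∷ []) ∷
  (3 ∷ 3 ∷ 4 ∷ 6 ∷ 1 ∷ 3 ∷ 3 ∷ 3 ∷ 3 ∷ 3 ∷ 4 ∷ 3 ∷ 0 ∷ 2 ∷ 3 ∷ 3 ∷ []) ∷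
  (3 ∷ 3 ∷ 4 ∷ 6 ∷ 0 ∷ 2 ∷ 3 ∷ 3 ∷ 3 ∷ 3 ∷ 4 ∷ 3 ∷ 0 ∷ 2 ∷ 3 ∷ 3 ∷ []) ∷
  []

nibble : Bool → Bool → Bool → Bool → Fin 16
nibble a b c d = combine (combine (digit a) (digit b)) (combine (digit c) (digit d))
  where
  digit : Bool → Fin 2
  digit false = zero
  digit true = suc zero

potential : Bool → Bool → Bool → Bool → Bool → Bool → Bool → Bool → ℕ
potential x₀ x₁ x₂ x₃ x₄ x₅ x₆ x₇ = lookup (lookup potentialTable (nibble x₀ x₁ x₂ x₃)) (nibble x₄ x₅ x₆ x₇)

windowCheck : Vec Bool 12 → Bool
windowCheck (x₀ ∷ x₁ ∷ x₂ ∷ x₃ ∷ x₄ ∷ x₅ ∷ x₆ ∷ x₇ ∷ x₈ ∷ x₉ ∷ x₁₀ ∷ x₁₁ ∷ []) =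
  6 * (bit x₆ + bit x₇ + bit x₈ + bit x₉) + penalty x₀ x₁ x₂ x₃ x₄ x₅ x₆ x₇ x₈ x₉ x₁₀ x₁₁
    + potential x₄ x₅ x₆ x₇ x₈ x₉ x₁₀ x₁₁
  ≤ᵇ 3 * (kPrivateCount x₄ x₅ x₆ x₇ x₈ x₉ x₁₀ x₁₁ + 4) + potential x₀ x₁ x₂ x₃ x₄ x₅ x₆ x₇

windowCheck-holds : T (allBits 12 windowCheck)
windowCheck-holds = _

module Windows (g : ℕ → Bool) where

  at : ℕ → ℕ → Bool
  at K o = g (o + K * 4)

  blockCount kPrivates penaltyAt potentialAt : ℕ → ℕ
  blockCount K = bit (at K 8) + bit (at K 9) + bit (at K 10) + bit (at K 11)
  kPrivates K = kPrivateCount (at K 6) (at K 7) (at K 8) (at K 9) (at K 10) (at K 11) (at K 12) (at K 13)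
  penaltyAt K = penalty (at K 2) (at K 3) (at K 4) (at K 5) (at K 6) (at K 7)
                        (at K 8) (at K 9) (at K 10) (at K 11) (at K 12) (at K 13)
  potentialAt K = potential (at K 2) (at K 3) (at K 4) (at K 5) (at K 6) (at K 7) (at K 8) (at K 9)

  window-step : ∀ K → 6 * blockCount K + penaltyAt K + potentialAt (suc K) ≤ 3 * (kPrivates K + 4) + potentialAt K
  window-step K = ≤ᵇ⇒≤ _ _ (allBits-sound 12 windowCheck windowCheck-holds
    (at K 2 ∷ at K 3 ∷ at K 4 ∷ at K 5 ∷ at K 6 ∷ at K 7 ∷ at K 8 ∷ at K 9 ∷ at K 10 ∷ at K 11 ∷ at K 12 ∷ at K 13 ∷ []))

telescope : ∀ M (g : ℕ → Bool) → let open Windows g in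
  sumTo M (λ K → 6 * blockCount K + penaltyAt K) + potentialAt M ≤ sumTo M (λ K → 3 * (kPrivates K + 4)) + potentialAt 0
telescope zero g = ≤-refl
telescope (suc M) g = begin
    first + rest + potentialAt (suc M)     ≡⟨ +-assoc first rest _ ⟩
    first + (rest + potentialAt (suc M))   ≤⟨ +-monoʳ-≤ first (telescope M (λ t → g (4 + t))) ⟩
    first + (gain + potentialAt 1)         ≡⟨ exchange first gain (potentialAt 1) ⟩
    gain + (first + potentialAt 1)         ≤⟨ +-monoʳ-≤ gain (window-step 0) ⟩
    gain + (3 * (kPrivates 0 + 4) + potentialAt 0) ≡⟨ exchange gain _ (potentialAt 0) ⟩
    3 * (kPrivates 0 + 4) + (gain + potentialAt 0) ≡⟨ +-assoc (3 * (kPrivates 0 + 4)) gain _ ⟨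
    3 * (kPrivates 0 + 4) + gain + potentialAt 0 ∎
  where
  open Windows g
  open ≤-Reasoning
  first rest gain : ℕ
  first = 6 * blockCount 0 + penaltyAt 0
  rest = sumTo M (λ K → 6 * blockCount (suc K) + penaltyAt (suc K))
  gain = sumTo M (λ K → 3 * (kPrivates (suc K) + 4))
  exchange : ∀ a b c → a + (b + c) ≡ b + (a + c)
  exchange a b c = trans (sym (+-assoc a b c)) (trans (cong (_+ c) (+-comm a b)) (+-assoc b a c))

padded : (ℕ → Bool) → ℕ → Bool
padded b (suc (suc (suc (suc (suc (suc (suc (suc (suc t))))))))) = b t
padded b _ = false

potential-start : ∀ b → potential false false false false false false false b ≡ 3
potential-start true = refl
potential-start false = refl

potentialEndCheck : Vec Bool 5 → Bool
potentialEndCheck (a ∷ b ∷ c ∷ d ∷ e ∷ []) = 3 ≤ᵇ potential a b c d e false false false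

potential-end : ∀ a b c d e → 3 ≤ potential a b c d e false false false
potential-end a b c d e = ≤ᵇ⇒≤ 3 _ (allBits-sound 5 potentialEndCheck _ (a ∷ b ∷ c ∷ d ∷ e ∷ []))

module _ (L : ℕ) (b : ℕ → Bool) (vanishes : ∀ k → b (k + 6 + L * 4) ≡ false) where
  open Windows (padded b)

  private
    M : ℕ
    M = 2 + L

    blocks-cover : sumTo M blockCount ≡ sumTo (6 + L * 4) (bit ∘ b)
    blocks-cover = begin
      sumTo M blockCount                                   ≡⟨ sumTo-blocks M (λ t → bit (padded b (8 + t))) ⟨
      sumTo (7 + L * 4) (bit ∘ b)                          ≡⟨ sumTo-last (6 + L * 4) (bit ∘ b) ⟩
      sumTo (6 + L * 4) (bit ∘ b) + bit (b (6 + L * 4))    ≡⟨ cong (λ x → sumTo (6 + L * 4) (bit ∘ b) + bit x) (vanishes 0) ⟩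
      sumTo (6 + L * 4) (bit ∘ b) + 0                      ≡⟨ +-identityʳ _ ⟩
      sumTo (6 + L * 4) (bit ∘ b) ∎
      where open ≡-Reasoning

    potential-at-end : 3 ≤ potentialAt M
    potential-at-end rewrite vanishes 0 | vanishes 1 | vanishes 2 = potential-end (at M 2) (at M 3) (at M 4) (at M 5) (at M 6)

  padded-bound : 6 * sumTo (6 + L * 4) (bit ∘ b) + sumTo M penaltyAt ≤ 3 * sumTo M kPrivates + 12 * M
  padded-bound = +-cancelʳ-≤ 3 _ _ (begin
      6 * sumTo (6 + L * 4) (bit ∘ b) + sumTo M penaltyAt + 3
        ≤⟨ +-monoʳ-≤ _ potential-at-end ⟩
      6 * sumTo (6 + L * 4) (bit ∘ b) + sumTo M penaltyAt + potentialAt M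
        ≡⟨ cong (λ x → 6 * x + sumTo M penaltyAt + potentialAt M) blocks-cover ⟨
      6 * sumTo M blockCount + sumTo M penaltyAt + potentialAt M
        ≡⟨ cong (_+ potentialAt M) (trans (sumTo-+ M (λ K → 6 * blockCount K) penaltyAt) (cong (_+ sumTo M penaltyAt) (sumTo-* M 6 blockCount))) ⟨
      sumTo M (λ K → 6 * blockCount K + penaltyAt K) + potentialAt M
        ≤⟨ telescope M (padded b) ⟩
      sumTo M (λ K → 3 * (kPrivates K + 4)) + potentialAt 0
        ≡⟨ cong (sumTo M (λ K → 3 * (kPrivates K + 4)) +_) (potential-start (b 0)) ⟩
      sumTo M (λ K → 3 * (kPrivates K + 4)) + 3
        ≡⟨ cong (_+ 3) gains ⟩
      3 * sumTo M kPrivates + 12 * M + 3 ∎)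
    where
    open ≤-Reasoning
    gains : sumTo M (λ K → 3 * (kPrivates K + 4)) ≡ 3 * sumTo M kPrivates + 12 * M
    gains = begin-equality
      sumTo M (λ K → 3 * (kPrivates K + 4))          ≡⟨ sumTo-* M 3 (λ K → kPrivates K + 4) ⟩
      3 * sumTo M (λ K → kPrivates K + 4)            ≡⟨ cong (3 *_) (sumTo-+ M kPrivates (λ _ → 4)) ⟩
      3 * (sumTo M kPrivates + sum {M} (λ _ → 4))    ≡⟨ cong (λ x → 3 * (sumTo M kPrivates + x)) (sum-const M 4) ⟩
      3 * (sumTo M kPrivates + M * 4)                ≡⟨ solve 2 (λ p M → con 3 :* (p :+ M :* con 4) := con 3 :* p :+ con 12 :* M) refl (sumTo M kPrivates) M ⟩
      3 * sumTo M kPrivates + 12 * M ∎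

penalty-free : ∀ u t u₀ e → bit (not u ∧ (not t ∨ (not u₀ ∧ not e))) ≡ 0 →
               u ≡ false → t ≡ true × (u₀ ≡ false → e ≡ true)
penalty-free false true u₀ true _ _ = refl , λ _ → refl
penalty-free false true true false _ _ = refl , λ ()

bitAt : Block → ℕ → Bool
bitAt (b₀ , _) 0 = b₀
bitAt (_ , b₁ , _) 1 = b₁
bitAt (_ , _ , b₂ , _) 2 = b₂
bitAt (_ , _ , _ , b₃) _ = b₃

-- The value v whose pair p_v is the set of positions of the block outside D (junk value zero if there is none).
decode : Block → Fin 6
decode (true , true , false , false) = zero
decode (false , true , true , false) = suc zero
decode (false , false , true , true) = suc (suc zero)
decode (true , false , false , true) = suc (suc (suc zero))
decode (true , false , true , false) = suc (suc (suc (suc zero)))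
decode (false , true , false , true) = suc (suc (suc (suc (suc zero))))
decode _ = zero

decodeCheck : Fin 6 → Vec Bool 4 → Bool
decodeCheck v (a ∷ b ∷ c ∷ d ∷ []) =
  not (exactlyTwo a b c d) ∨ bitAt (a , b , c , d) (proj₁ (pairOf v)) ∨ bitAt (a , b , c , d) (proj₂ (pairOf v))
  ∨ ⌊ decode (a , b , c , d) Finₚ.≟ v ⌋

decodeCheck-holds : ∀ v → T (allBits 4 (decodeCheck v))
decodeCheck-holds zero = _
decodeCheck-holds (suc zero) = _
decodeCheck-holds (suc (suc zero)) = _
decodeCheck-holds (suc (suc (suc zero))) = _
decodeCheck-holds (suc (suc (suc (suc zero)))) = _
decodeCheck-holds (suc (suc (suc (suc (suc zero))))) = _

decode-correct : ∀ v a b c d → exactlyTwo a b c d ≡ true →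
  bitAt (a , b , c , d) (proj₁ (pairOf v)) ≡ false → bitAt (a , b , c , d) (proj₂ (pairOf v)) ≡ false →
  decode (a , b , c , d) ≡ v
decode-correct v a b c d two p₁ p₂ with allBits-sound 4 (decodeCheck v) (decodeCheck-holds v) (a ∷ b ∷ c ∷ d ∷ [])
... | ok rewrite two | p₁ | p₂ = toWitness {a? = decode (a , b , c , d) Finₚ.≟ v} ok

module Padded (b : ℕ → Bool) where

  g : ℕ → Bool
  g = padded b

  kPrivateAt kDominatedAt : ℕ → Bool
  kPrivateAt t = kPrivate (g (7 + t)) (g (8 + t)) (b t) (b (1 + t)) (b (2 + t))
  kDominatedAt t = kDominated (g (8 + t)) (b t) (b (1 + t))

  g-true : ∀ t → g (8 + t) ≡ true → Σ ℕ λ t′ → t ≡ suc t′ × b t′ ≡ true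
  g-true (suc t′) bt = t′ , refl , bt

-- Private neighbours in finite graphs

¬¬-all : ∀ {A : Set} (P : A → Set) xs → (∀ x → x ∈ xs → DoubleNegation (P x)) → DoubleNegation (∀ x → x ∈ xs → P x)
¬¬-all P [] _ k = k λ _ ()
¬¬-all P (y ∷ ys) ¬¬P k =
  ¬¬P y (here refl) λ Py → ¬¬-all P ys (λ x p → ¬¬P x (there p)) λ Pys →
    k λ { x (here refl) → Py ; x (there p) → Pys x p }

concatFin : ∀ {A : Set} k → (Fin k → List A) → List A
concatFin zero g = []
concatFin (suc k) g = g zero ++ concatFin k (g ∘ suc)

∈-concatFin : ∀ {A : Set} k (g : Fin k → List A) i {x} → x ∈ g i → x ∈ concatFin k g
∈-concatFin (suc k) g zero p = ∈-++⁺ˡ p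
∈-concatFin (suc k) g (suc i) p = ∈-++⁺ʳ (g zero) (∈-concatFin k (g ∘ suc) i p)

module FiniteGraph {V : Set} (Adj : V → V → Set) (_≟_ : DecidableEquality V)
                   (vertices : List V) (∈-vertices : ∀ v → v ∈ vertices) where

  open import Data.List.Membership.DecPropositional _≟_ public using (_∈?_)

  count : (V → ℕ) → List V → ℕ
  count f [] = 0
  count f (x ∷ xs) = f x + count f xs

  count-mono : ∀ {f g} xs → (∀ x → f x ≤ g x) → count f xs ≤ count g xs
  count-mono [] _ = z≤n
  count-mono (x ∷ xs) f≤g = +-mono-≤ (f≤g x) (count-mono xs f≤g)

  count-+ : ∀ f g xs → count (λ x → f x + g x) xs ≡ count f xs + count g xs
  count-+ f g [] = refl
  count-+ f g (x ∷ xs) rewrite count-+ f g xs = interchange (f x) (g x) _ _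

  count-++ : ∀ f xs ys → count f (xs ++ ys) ≡ count f xs + count f ys
  count-++ f [] ys = refl
  count-++ f (x ∷ xs) ys = trans (cong (f x +_) (count-++ f xs ys)) (sym (+-assoc (f x) _ _))

  count-concatFin : ∀ f k (g : Fin k → List V) → count f (concatFin k g) ≡ sum (λ i → count f (g i))
  count-concatFin f zero g = refl
  count-concatFin f (suc k) g = trans (count-++ f (g zero) _) (cong (count f (g zero) +_) (count-concatFin f k (g ∘ suc)))

  memberOf : List V → V → Bool
  memberOf X v = does (v ∈? X)

  count-≟-pos : ∀ x xs → x ∈ xs → 1 ≤ count (λ v → bit (does (v ≟ x))) xs
  count-≟-pos x (y ∷ xs) (here refl) with x ≟ x
  ... | yes _ = s≤s z≤n
  ... | no x≢x = contradiction refl x≢x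
  count-≟-pos x (y ∷ xs) (there x∈xs) = ≤-trans (count-≟-pos x xs x∈xs) (m≤n+m _ _)

  length≤count-members : ∀ X → Unique X → length X ≤ count (bit ∘ memberOf X) vertices
  length≤count-members [] _ = z≤n
  length≤count-members (x ∷ X) (x∉X ∷ uniqueX) = begin
      suc (length X)
        ≤⟨ +-mono-≤ (count-≟-pos x vertices (∈-vertices x)) (length≤count-members X uniqueX) ⟩
      count (λ v → bit (does (v ≟ x))) vertices + count (bit ∘ memberOf X) vertices
        ≡⟨ count-+ _ _ vertices ⟨
      count (λ v → bit (does (v ≟ x)) + bit (memberOf X v)) vertices
        ≤⟨ count-mono vertices bound ⟩
      count (bit ∘ memberOf (x ∷ X)) vertices ∎
    where
    open ≤-Reasoning
    bound : ∀ v → bit (does (v ≟ x)) + bit (memberOf X v) ≤ bit (memberOf (x ∷ X) v)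
    bound v with v ≟ x | v ∈? X
    ... | yes refl | yes v∈X = contradiction refl (All.lookup x∉X v∈X)
    ... | yes _ | no _ = ≤-refl
    ... | no _ | yes _ = ≤-refl
    ... | no _ | no _ = z≤n

  Dominating : List V → Set
  Dominating D = ∀ v → v ∈ D ⊎ ∃[ x ] (x ∈ D × Adj x v)

  Dominates : V → V → Set
  Dominates z y = z ≡ y ⊎ Adj z y

  module MinimalDominating (D : List V) (dominating : Dominating D)
    (minimal : ∀ (D′ : List V) → (∀ x → x ∈ D′ → x ∈ D) → Dominating D′ → ∀ x → x ∈ D → x ∈ D′) where

    dominator : ∀ v → Σ V λ z → z ∈ D × Dominates z v
    dominator v with dominating v
    ... | inj₁ v∈D = v , v∈D , inj₁ refl
    ... | inj₂ (z , z∈D , adj) = z , z∈D , inj₂ adj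

    PrivateNeighbour : V → V → Set
    PrivateNeighbour x y = Dominates x y × (∀ z → z ∈ D → Dominates z y → z ≡ x)

    -- Without a private neighbour of x, D minus x would still be dominating.
    private-neighbour : ∀ x → x ∈ D → DoubleNegation (Σ V (PrivateNeighbour x))
    private-neighbour x x∈D noPrivate =
      ¬¬-all DominatedWithout vertices (λ v _ → ¬¬-dominatedWithout v)
        λ dom → x∉D′ (minimal D′ D′⊆D (λ v → dom v (∈-vertices v)) x x∈D)
      where
      D′ : List V
      D′ = filter (λ v → ¬? (v ≟ x)) D
      D′⊆D : ∀ y → y ∈ D′ → y ∈ D
      D′⊆D y p = proj₁ (∈-filter⁻ (λ v → ¬? (v ≟ x)) {xs = D} p)
      x∉D′ : ¬ (x ∈ D′)
      x∉D′ p = proj₂ (∈-filter⁻ (λ v → ¬? (v ≟ x)) {xs = D} p) refl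
      ∈D′ : ∀ {y} → y ∈ D → ¬ (y ≡ x) → y ∈ D′
      ∈D′ p y≢x = ∈-filter⁺ (λ v → ¬? (v ≟ x)) p y≢x
      DominatedWithout : V → Set
      DominatedWithout v = v ∈ D′ ⊎ ∃[ z ] (z ∈ D′ × Adj z v)
      fromOther : ∀ {v} z → z ∈ D → Dominates z v → ¬ (z ≡ x) → DominatedWithout v
      fromOther z z∈D (inj₁ refl) z≢x = inj₁ (∈D′ z∈D z≢x)
      fromOther z z∈D (inj₂ adj) z≢x = inj₂ (z , ∈D′ z∈D z≢x , adj)
      ¬¬-dominatedWithout : ∀ v → DoubleNegation (DominatedWithout v)
      ¬¬-dominatedWithout v k with dominator v
      ... | z , z∈D , z▷v with z ≟ x
      ... | no z≢x = k (fromOther z z∈D z▷v z≢x)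
      ... | yes refl = noPrivate (v , z▷v , onlyX)
        where
        onlyX : ∀ y → y ∈ D → Dominates y v → y ≡ x
        onlyX y y∈D y▷v with y ≟ x
        ... | yes y≡x = y≡x
        ... | no y≢x = contradiction (fromOther y y∈D y▷v y≢x) k

-- The graph of the construction

module Graph {q n m : ℕ} (φ : CSP6 q n m) where
  open CSP6 φ public
  open Construction φ public

  pathLength : ℕ
  pathLength = 4 * F * m + 6

  private
    Gadget : Set
    Gadget = Σ (Fin (F * m)) λ j → Fin (C (j′ j)) × Fin A

    Code : Set
    Code = (Fin n × Fin pathLength) ⊎ Gadget ⊎ Gadget ⊎ Fin (F * m)

    toCode : V → Code
    toCode (u i t) = inj₁ (i , t)
    toCode (kv j l a) = inj₂ (inj₁ (j , l , a))
    toCode (lv j l a) = inj₂ (inj₂ (inj₁ (j , l , a)))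
    toCode (w j) = inj₂ (inj₂ (inj₂ j))

    fromCode : Code → V
    fromCode (inj₁ (i , t)) = u i t
    fromCode (inj₂ (inj₁ (j , l , a))) = kv j l a
    fromCode (inj₂ (inj₂ (inj₁ (j , l , a)))) = lv j l a
    fromCode (inj₂ (inj₂ (inj₂ j))) = w j

    fromCode-toCode : ∀ x → fromCode (toCode x) ≡ x
    fromCode-toCode (u _ _) = refl
    fromCode-toCode (kv _ _ _) = refl
    fromCode-toCode (lv _ _ _) = refl
    fromCode-toCode (w _) = refl

    _≟ᴳ_ : DecidableEquality Gadget
    _≟ᴳ_ = ≡-dec Finₚ._≟_ (≡-dec Finₚ._≟_ Finₚ._≟_)

    _≟ᶜ_ : DecidableEquality Code
    _≟ᶜ_ = Sumₚ.≡-dec (≡-dec Finₚ._≟_ Finₚ._≟_) (Sumₚ.≡-dec _≟ᴳ_ (Sumₚ.≡-dec _≟ᴳ_ Finₚ._≟_))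

  _≟ⱽ_ : DecidableEquality V
  x ≟ⱽ y = map′ toCode-injective (cong toCode) (toCode x ≟ᶜ toCode y)
    where
    toCode-injective : toCode x ≡ toCode y → x ≡ y
    toCode-injective e = trans (sym (fromCode-toCode x)) (trans (cong fromCode e) (fromCode-toCode y))

  gadgetVertices : Fin (F * m) → List V
  gadgetVertices j = concatFin (C (j′ j)) (λ l → concatFin A (λ a → kv j l a ∷ lv j l a ∷ [])) ++ (w j ∷ [])

  pathVertices : Fin n → List V
  pathVertices i = concatFin pathLength (λ t → u i t ∷ [])

  vertices : List V
  vertices = concatFin n pathVertices ++ concatFin (F * m) gadgetVertices

  ∈-vertices : ∀ x → x ∈ vertices
  ∈-vertices (u i t) = ∈-++⁺ˡ (∈-concatFin n _ i (∈-concatFin pathLength _ t (here refl)))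
  ∈-vertices (kv j l a) = ∈-++⁺ʳ _ (∈-concatFin (F * m) gadgetVertices j (∈-++⁺ˡ (∈-concatFin _ _ l (∈-concatFin A _ a (here refl)))))
  ∈-vertices (lv j l a) = ∈-++⁺ʳ _ (∈-concatFin (F * m) gadgetVertices j (∈-++⁺ˡ (∈-concatFin _ _ l (∈-concatFin A _ a (there (here refl))))))
  ∈-vertices (w j) = ∈-++⁺ʳ _ (∈-concatFin (F * m) gadgetVertices j (∈-++⁺ʳ _ (here refl)))

  open FiniteGraph Adj _≟ⱽ_ vertices ∈-vertices public hiding (Dominating)

  adj-sym : ∀ {x y} → Adj x y → Adj y x
  adj-sym (inj₁ e) = inj₂ e
  adj-sym (inj₂ e) = inj₁ e

  data UNbr (i : Fin n) (t : Fin pathLength) : V → Set where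
    pathPred : ∀ t′ → toℕ t ≡ suc (toℕ t′) → UNbr i t (u i t′)
    pathSucc : ∀ t′ → toℕ t′ ≡ suc (toℕ t) → UNbr i t (u i t′)
    gadget   : ∀ j l a s o → scope (j′ j) s ≡ i → InPair (acc (j′ j) l s) o →
               toℕ t ≡ 4 * toℕ j + o + 3 → UNbr i t (kv j l a)

  uNbr : ∀ {i t z} → Adj z (u i t) → UNbr i t z
  uNbr (inj₁ (path i t′ t e)) = pathPred t′ e
  uNbr (inj₂ (path i t t′ e)) = pathSucc t′ e
  uNbr (inj₂ (pair j l a s t o p e)) = gadget j l a s o refl p e

  data KNbr (j : Fin (F * m)) (l : Fin (C (j′ j))) (a : Fin A) : V → Set where
    clique  : ∀ l′ a′ → ¬ (l′ ≡ l × a′ ≡ a) → KNbr j l a (kv j l′ a′)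
    matched : KNbr j l a (lv j l a)
    cross   : ∀ l′ a′ → ¬ (l ≡ l′) → KNbr j l a (lv j l′ a′)
    path    : ∀ s t o → InPair (acc (j′ j) l s) o → toℕ t ≡ 4 * toℕ j + o + 3 →
              KNbr j l a (u (scope (j′ j) s) t)

  kNbr : ∀ {j l a z} → Adj z (kv j l a) → KNbr j l a z
  kNbr (inj₁ (Kcl j l′ a′ l a ≢)) = clique l′ a′ ≢
  kNbr (inj₁ (pair j l a s t o p e)) = path s t o p e
  kNbr (inj₂ (Kcl j l a l′ a′ ≢)) = clique l′ a′ λ { (refl , refl) → ≢ (refl , refl) }
  kNbr (inj₂ (match j l a)) = matched
  kNbr (inj₂ (KL j l a l′ a′ ≢)) = cross l′ a′ ≢

  data LNbr (j : Fin (F * m)) (l : Fin (C (j′ j))) (a : Fin A) : V → Set where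
    clique  : ∀ l′ a′ → ¬ (l′ ≡ l × a′ ≡ a) → LNbr j l a (lv j l′ a′)
    matched : LNbr j l a (kv j l a)
    cross   : ∀ l′ a′ → ¬ (l′ ≡ l) → LNbr j l a (kv j l′ a′)
    hub     : LNbr j l a (w j)

  lNbr : ∀ {j l a z} → Adj z (lv j l a) → LNbr j l a z
  lNbr (inj₁ (Lcl j l′ a′ l a ≢)) = clique l′ a′ ≢
  lNbr (inj₁ (match j l a)) = matched
  lNbr (inj₁ (KL j l′ a′ l a ≢)) = cross l′ a′ ≢
  lNbr (inj₁ (wL j l a)) = hub
  lNbr (inj₂ (Lcl j l a l′ a′ ≢)) = clique l′ a′ λ { (refl , refl) → ≢ (refl , refl) }

  wNbr : ∀ {j z} → Adj z (w j) → Σ (Fin (C (j′ j))) λ l → Σ (Fin A) λ a → z ≡ lv j l a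
  wNbr (inj₂ (wL j l a)) = l , a , refl

-- Paths

module Membership {q n m : ℕ} (φ : CSP6 q n m) (D : List (Construction.V φ)) (UD : Construction.UpperDominating φ D) where
  open Graph φ public
  open MinimalDominating D (proj₁ (proj₂ UD)) (proj₂ (proj₂ UD)) public

  inD : V → Bool
  inD = memberOf D

  inD-true⇒∈ : ∀ {v} → inD v ≡ true → v ∈ D
  inD-true⇒∈ {v} = does≡true (v ∈? D)

  inD-false⇒∉ : ∀ {v} → inD v ≡ false → ¬ v ∈ D
  inD-false⇒∉ {v} v∉D v∈D with () ← trans (sym (dec-true (v ∈? D) v∈D)) v∉D

  ∉⇒inD-false : ∀ {v} → ¬ v ∈ D → inD v ≡ false
  ∉⇒inD-false {v} = dec-false (v ∈? D)

  -- Whether u i t ∈ D, with junk value false beyond the end of the path.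
  pathBit : Fin n → ℕ → Bool
  pathBit i t with t <? pathLength
  ... | yes t< = inD (u i (fromℕ< t<))
  ... | no _ = false

  pathBit-true : ∀ i t → pathBit i t ≡ true → Σ (Fin pathLength) λ t′ → toℕ t′ ≡ t × u i t′ ∈ D
  pathBit-true i t e with t <? pathLength
  ... | yes t< = fromℕ< t< , Finₚ.toℕ-fromℕ< t< , inD-true⇒∈ e

  pathBit-toℕ : ∀ i (t : Fin pathLength) → pathBit i (toℕ t) ≡ inD (u i t)
  pathBit-toℕ i t with toℕ t <? pathLength
  ... | yes t< = cong (λ t′ → inD (u i t′)) (Finₚ.fromℕ<-toℕ t t<)
  ... | no t≮ = contradiction (Finₚ.toℕ<n t) t≮

  pathBit-beyond : ∀ i t → pathLength ≤ t → pathBit i t ≡ false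
  pathBit-beyond i t ≥len with t <? pathLength
  ... | yes t< = contradiction (≤-trans t< ≥len) (<-irrefl refl)
  ... | no _ = refl

  module OnPath (i : Fin n) where
    open Padded (pathBit i) public
    open Windows g public

  KPrivate : Fin n → Fin pathLength → Set
  KPrivate i t = Σ (Fin (F * m)) λ j → Σ (Fin (C (j′ j))) λ l → Σ (Fin A) λ a →
                   KNbr j l a (u i t) × PrivateNeighbour (u i t) (kv j l a)

  module _ (i : Fin n) (t : Fin pathLength) where
    open OnPath i
    private
      pos : ℕ
      pos = toℕ t

      Private : V → Set
      Private y = ∀ z → z ∈ D → Dominates z y → z ≡ u i t

      otherDominator : ∀ {y} t′ → toℕ t′ ≢ pos → u i t′ ∈ D → Dominates (u i t′) y → ¬ Private y
      otherDominator t′ t′≢t t′∈D t′▷y private′ with private′ _ t′∈D t′▷y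
      ... | refl = t′≢t refl

      adjacent : ∀ (t₁ t₂ : Fin pathLength) → toℕ t₂ ≡ suc (toℕ t₁) → Adj (u i t₁) (u i t₂)
      adjacent t₁ t₂ e = inj₁ (path i t₁ t₂ e)

      n≢2+n : ∀ {k} → k ≢ suc (suc k)
      n≢2+n {k} e = m≢1+m+n k {1} (trans e (cong suc (+-comm 1 k)))

      self-not-private : g (8 + pos) ≡ true ⊎ pathBit i (1 + pos) ≡ true → ¬ Private (u i t)
      self-not-private (inj₁ left) with g-true pos left
      ... | s , pos≡1+s , bit-s with pathBit-true i s bit-s
      ...   | t′ , t′≡s , t′∈D =
        otherDominator t′ (λ e → 1+n≢n (sym (trans (sym t′≡s) (trans e pos≡1+s)))) t′∈D
          (inj₂ (adjacent t′ t (trans pos≡1+s (cong suc (sym t′≡s)))))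
      self-not-private (inj₂ right) with pathBit-true i (1 + pos) right
      ... | t′ , t′≡1+pos , t′∈D =
        otherDominator t′ (λ e → 1+n≢n (trans (sym t′≡1+pos) e)) t′∈D (inj₂ (adj-sym (adjacent t t′ t′≡1+pos)))

      pred-not-private : ∀ t′ → pos ≡ suc (toℕ t′) → g (8 + pos) ≡ true ⊎ g (7 + pos) ≡ true → ¬ Private (u i t′)
      pred-not-private t′ pos≡1+t′ (inj₁ left) with g-true pos left
      ... | s , pos≡1+s , bit-s with pathBit-true i s bit-s
      ...   | t₁ , t₁≡s , t₁∈D =
        otherDominator t₁ (λ e → 1+n≢n (sym (trans (sym t₁≡s) (trans e pos≡1+s)))) t₁∈D
          (inj₁ (cong (u i) (Finₚ.toℕ-injective (trans t₁≡s (suc-injective (trans (sym pos≡1+s) pos≡1+t′))))))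
      pred-not-private t′ pos≡1+t′ (inj₂ left²) with g-true (toℕ t′) (subst (λ x → g (7 + x) ≡ true) pos≡1+t′ left²)
      ... | s , t′≡1+s , bit-s with pathBit-true i s bit-s
      ...   | t₁ , t₁≡s , t₁∈D =
        otherDominator t₁ (λ e → n≢2+n (trans (sym t₁≡s) (trans e (trans pos≡1+t′ (cong suc t′≡1+s))))) t₁∈D
          (inj₂ (adjacent t₁ t′ (trans t′≡1+s (cong suc (sym t₁≡s)))))

      succ-not-private : ∀ t′ → toℕ t′ ≡ suc pos → pathBit i (1 + pos) ≡ true ⊎ pathBit i (2 + pos) ≡ true → ¬ Private (u i t′)
      succ-not-private t′ t′≡1+pos (inj₁ right) with pathBit-true i (1 + pos) right
      ... | t₁ , t₁≡1+pos , t₁∈D =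
        otherDominator t₁ (λ e → 1+n≢n (trans (sym t₁≡1+pos) e)) t₁∈D
          (inj₁ (cong (u i) (Finₚ.toℕ-injective (trans t₁≡1+pos (sym t′≡1+pos)))))
      succ-not-private t′ t′≡1+pos (inj₂ right²) with pathBit-true i (2 + pos) right²
      ... | t₁ , t₁≡2+pos , t₁∈D =
        otherDominator t₁ (λ e → n≢2+n (sym (trans (sym t₁≡2+pos) e))) t₁∈D
          (inj₂ (adj-sym (adjacent t′ t₁ (trans t₁≡2+pos (cong suc (sym t′≡1+pos))))))

    kPrivate-facts : kPrivateAt pos ≡ true →
      pathBit i pos ≡ true × (g (8 + pos) ≡ true ⊎ pathBit i (1 + pos) ≡ true) ×
      (g (8 + pos) ≡ true ⊎ g (7 + pos) ≡ true) × (pathBit i (1 + pos) ≡ true ⊎ pathBit i (2 + pos) ≡ true)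
    kPrivate-facts = kPrivate-elim (g (7 + pos)) (g (8 + pos)) (pathBit i pos) (pathBit i (1 + pos)) (pathBit i (2 + pos))

    kPrivate⇒∈D : kPrivateAt pos ≡ true → u i t ∈ D
    kPrivate⇒∈D kp = inD-true⇒∈ (trans (sym (pathBit-toℕ i t)) (proj₁ (kPrivate-facts kp)))

    kPrivate-sound : kPrivateAt pos ≡ true → DoubleNegation (KPrivate i t)
    kPrivate-sound kp noK with kPrivate-facts kp
    ... | _ , self , pred , succ =
      private-neighbour (u i t) (kPrivate⇒∈D kp) λ { (y , t▷y , private′) → onlyK y t▷y private′ }
      where
      onlyK : ∀ y → Dominates (u i t) y → ¬ Private y
      onlyK y (inj₁ refl) = self-not-private self
      onlyK y (inj₂ adj) private′ with uNbr (adj-sym adj)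
      ... | gadget j l a s o _ _ _ = noK (j , l , a , kNbr adj , inj₂ adj , private′)
      ... | pathPred t′ e = pred-not-private t′ e pred private′
      ... | pathSucc t′ e = succ-not-private t′ e succ private′

    kDominated-sound : kDominatedAt pos ≡ true →
      Σ (Fin (F * m)) λ j → Σ (Fin (C (j′ j))) λ l → Σ (Fin A) λ a → kv j l a ∈ D × KNbr j l a (u i t)
    kDominated-sound kd with kDominated-elim _ _ _ kd | dominator (u i t)
    ... | _ , t∉D , _ | z , z∈D , inj₁ refl =
      contradiction z∈D (inD-false⇒∉ (trans (sym (pathBit-toℕ i t)) t∉D))
    ... | pred∉D , _ , succ∉D | z , z∈D , inj₂ adj with uNbr adj
    ...   | gadget j l a _ _ _ _ _ = j , l , a , z∈D , kNbr (adj-sym adj)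
    ...   | pathPred t′ pos≡1+t′ =
      contradiction z∈D (inD-false⇒∉ (trans (sym (pathBit-toℕ i t′)) (subst (λ x → g (8 + x) ≡ false) pos≡1+t′ pred∉D)))
    ...   | pathSucc t′ t′≡1+pos =
      contradiction z∈D (inD-false⇒∉ (trans (sym (pathBit-toℕ i t′)) (subst (λ x → pathBit i x ≡ false) (sym t′≡1+pos) succ∉D)))

-- The gadget budget

inPair≤3 : ∀ v o → InPair v o → o ≤ 3
inPair≤3 zero _ (inj₁ refl) = s≤s (s≤s z≤n)
inPair≤3 zero _ (inj₂ refl) = ≤-refl
inPair≤3 (suc zero) _ (inj₁ refl) = ≤-refl
inPair≤3 (suc zero) _ (inj₂ refl) = z≤n
inPair≤3 (suc (suc zero)) _ (inj₁ refl) = z≤n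
inPair≤3 (suc (suc zero)) _ (inj₂ refl) = s≤s z≤n
inPair≤3 (suc (suc (suc zero))) _ (inj₁ refl) = s≤s z≤n
inPair≤3 (suc (suc (suc zero))) _ (inj₂ refl) = s≤s (s≤s z≤n)
inPair≤3 (suc (suc (suc (suc zero)))) _ (inj₁ refl) = s≤s z≤n
inPair≤3 (suc (suc (suc (suc zero)))) _ (inj₂ refl) = ≤-refl
inPair≤3 (suc (suc (suc (suc (suc zero))))) _ (inj₁ refl) = z≤n
inPair≤3 (suc (suc (suc (suc (suc zero))))) _ (inj₂ refl) = s≤s (s≤s z≤n)

-- u i (blockPos J o) is the vertex u_{i+1,4J+o} of block J; the edge condition of Defs writes it as 4 * J + o + 3.
blockPos : ℕ → ℕ → ℕ
blockPos J o = o + 3 + J * 4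

edgePos≡blockPos : ∀ J o → 4 * J + o + 3 ≡ blockPos J o
edgePos≡blockPos = solve 2 (λ J o → con 4 :* J :+ o :+ con 3 := o :+ con 3 :+ J :* con 4) refl

blockPos-< : ∀ {J J′} o o′ → J < J′ → o ≤ 3 → blockPos J o < blockPos J′ o′
blockPos-< {J} {J′} o o′ J<J′ o≤3 = begin-strict
    o + 3 + J * 4        ≤⟨ +-monoˡ-≤ (J * 4) (+-monoˡ-≤ 3 o≤3) ⟩
    3 + 3 + J * 4        <⟨ +-monoʳ-≤ 6 (≤-refl {suc (J * 4)}) ⟩
    3 + suc J * 4        ≤⟨ +-monoʳ-≤ 3 (*-monoˡ-≤ 4 J<J′) ⟩
    3 + J′ * 4           ≤⟨ +-monoˡ-≤ (J′ * 4) (m≤n+m 3 o′) ⟩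
    o′ + 3 + J′ * 4 ∎
  where open ≤-Reasoning

blockPos-injective : ∀ {J J′} o o′ → o ≤ 3 → o′ ≤ 3 → blockPos J o ≡ blockPos J′ o′ → J ≡ J′ × o ≡ o′
blockPos-injective {J} {J′} o o′ o≤3 o′≤3 e with <-cmp J J′
... | tri< J<J′ _ _ = contradiction e (<⇒≢ (blockPos-< o o′ J<J′ o≤3))
... | tri> _ _ J>J′ = contradiction (sym e) (<⇒≢ (blockPos-< o′ o J>J′ o′≤3))
... | tri≈ _ refl _ = refl , +-cancelʳ-≡ 3 o o′ (+-cancelʳ-≡ (J * 4) (o + 3) (o′ + 3) e)


fits-hub : ∀ q → 2 * 1 + 4 * q + 1 ≤ 2 * Aof q
fits-hub q = begin
    2 * 1 + 4 * q + 1       ≡⟨ solve 1 (λ q → con 2 :+ con 4 :* q :+ con 1 := con 4 :* q :+ con 3) refl q ⟩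
    4 * q + 3               ≤⟨ +-mono-≤ (m≤n+m (4 * q) (4 * q)) (n≤1+n 3) ⟩
    4 * q + 4 * q + 4       ≡⟨ solve 1 (λ q → con 4 :* q :+ con 4 :* q :+ con 4 := con 2 :* (con 4 :* q :+ con 2)) refl q ⟩
    2 * Aof q ∎
  where open ≤-Reasoning

fits-large : ∀ q → 2 * (4 * q + 1) + 1 + 1 ≤ 2 * Aof q
fits-large q = ≤-reflexive (solve 1 (λ q → con 2 :* (con 4 :* q :+ con 1) :+ con 1 :+ con 1 := con 2 :* (con 4 :* q :+ con 2)) refl q)

fits-few : ∀ q b → b ≤ 1 → (q ≡ 0 → b ≡ 0) → 2 * 2 + 0 + b ≤ 2 * Aof q
fits-few zero b _ b≡0 rewrite b≡0 refl = ≤-refl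
fits-few (suc q) b b≤1 _ = begin
    4 + b                   ≤⟨ +-monoʳ-≤ 4 b≤1 ⟩
    5                       ≤⟨ m≤m+n 5 (7 + 8 * q) ⟩
    5 + (7 + 8 * q)         ≡⟨ solve 1 (λ q → con 5 :+ (con 7 :+ con 8 :* q) := con 2 :* (con 4 :* (con 1 :+ q) :+ con 2)) refl q ⟩
    2 * Aof (suc q) ∎
  where open ≤-Reasoning

module Gadget {q n m : ℕ} (φ : CSP6 q n m) (D : List (Construction.V φ)) (UD : Construction.UpperDominating φ D)
              (j : Fin (Fof n * m)) where
  open Membership φ D UD

  r : Fin m
  r = j′ j

  J : ℕ
  J = toℕ j

  kIn lIn : Fin (C r) → Fin A → Bool
  kIn l a = inD (kv j l a)
  lIn l a = inD (lv j l a)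

  wIn : Bool
  wIn = inD (w j)

  countK countL : ℕ
  countK = sum λ l → sum λ a → bit (kIn l a)
  countL = sum λ l → sum λ a → bit (lIn l a)

  kPrivateOn kDominatedOn : Fin n → ℕ → Bool
  kPrivateOn i = OnPath.kPrivateAt i
  kDominatedOn i = OnPath.kDominatedAt i

  blockPos<pathLength : ∀ o → o < 4 → blockPos J o < pathLength
  blockPos<pathLength o o<4 = begin-strict
      o + 3 + J * 4          <⟨ +-monoˡ-< (J * 4) (+-monoˡ-< 3 o<4) ⟩
      3 + suc J * 4          ≤⟨ +-monoʳ-≤ 3 (*-monoˡ-≤ 4 (Finₚ.toℕ<n j)) ⟩
      3 + F * m * 4          ≤⟨ +-monoˡ-≤ (F * m * 4) (m≤m+n 3 3) ⟩
      6 + F * m * 4          ≡⟨ +-comm 6 (F * m * 4) ⟩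
      F * m * 4 + 6          ≡⟨ cong (_+ 6) (trans (*-comm (F * m) 4) (sym (*-assoc 4 F m))) ⟩
      pathLength ∎
    where open ≤-Reasoning

  -- Opaque because normalising the bound proof inside fromℕ< makes with-abstraction over these vertices very costly.
  opaque
    vertexAt : ∀ o → o < 4 → Fin pathLength
    vertexAt o o<4 = fromℕ< (blockPos<pathLength o o<4)

    toℕ-vertexAt : ∀ o o<4 → toℕ (vertexAt o o<4) ≡ blockPos J o
    toℕ-vertexAt o o<4 = Finₚ.toℕ-fromℕ< (blockPos<pathLength o o<4)

  privates kUses : ℕ
  privates = sum λ i → sumTo 4 λ o → bit (kPrivateOn i (blockPos J o))
  kUses = sum λ i → sumTo 4 λ o → bit (kPrivateOn i (blockPos J o) ∨ kDominatedOn i (blockPos J o))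

  Agrees : Fin (C r) → Fin q → Set
  Agrees l s = pathBit (scope r s) (4 * J + proj₁ (pairOf (acc r l s)) + 3) ≡ false ×
               pathBit (scope r s) (4 * J + proj₂ (pairOf (acc r l s)) + 3) ≡ false

  Clean : Set
  Clean = (Σ (Fin (C r)) λ l → ∀ s → Agrees l s) × kUses ≡ 0

  clean? : Dec Clean
  clean? = Finₚ.any? (λ l → Finₚ.all? λ s → (_ Boolₚ.≟ false) ×-dec (_ Boolₚ.≟ false)) ×-dec (kUses ≟ 0)

  bad : ℕ
  bad = bit (not (does clean?))

  bad≡0⇒clean : bad ≡ 0 → Clean
  bad≡0⇒clean = bit-not-does≡0 clean?

  KPrivateHere : Fin n → Fin pathLength → Set
  KPrivateHere i t = Σ (Fin (C r)) λ l → Σ (Fin A) λ a → KNbr j l a (u i t) × PrivateNeighbour (u i t) (kv j l a)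

  kNbr-in-block : ∀ {i t} o → o ≤ 3 → toℕ t ≡ blockPos J o → ∀ j₁ (l : Fin (C (j′ j₁))) a → KNbr j₁ l a (u i t) → j₁ ≡ j
  kNbr-in-block o o≤3 t≡ j₁ l a (path s _ o′ inPair t≡′) =
    Finₚ.toℕ-injective (proj₁ (blockPos-injective o′ o (inPair≤3 (acc (j′ j₁) l s) o′ inPair) o≤3
      (trans (sym (edgePos≡blockPos (toℕ j₁) o′)) (trans (sym t≡′) t≡))))

  kPrivate-here : ∀ i o (o<4 : o < 4) → kPrivateOn i (blockPos J o) ≡ true → DoubleNegation (KPrivateHere i (vertexAt o o<4))
  kPrivate-here i o o<4 kp noK =
    kPrivate-sound i (vertexAt o o<4) (subst (λ x → kPrivateOn i x ≡ true) (sym (toℕ-vertexAt o o<4)) kp) elsewhere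
    where
    relocate : ∀ {j₁} → j₁ ≡ j → (Σ (Fin (C (j′ j₁))) λ l → Σ (Fin A) λ a →
                 KNbr j₁ l a (u i (vertexAt o o<4)) × PrivateNeighbour (u i (vertexAt o o<4)) (kv j₁ l a)) → ⊥
    relocate refl (l , a , nbr , priv) = noK (l , a , nbr , priv)
    elsewhere : ¬ KPrivate i (vertexAt o o<4)
    elsewhere (j₁ , l , a , nbr , priv) = relocate (kNbr-in-block o (≤-pred o<4) (toℕ-vertexAt o o<4) j₁ l a nbr) (l , a , nbr , priv)

  kDominated-here : ∀ i o (o<4 : o < 4) → kDominatedOn i (blockPos J o) ≡ true →
    Σ (Fin (C r)) λ l → Σ (Fin A) λ a → kv j l a ∈ D × KNbr j l a (u i (vertexAt o o<4))
  kDominated-here i o o<4 kd = locate (kDominated-sound i (vertexAt o o<4) (subst (λ x → kDominatedOn i x ≡ true) (sym (toℕ-vertexAt o o<4)) kd))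
    where
    relocate : ∀ {j₁} → j₁ ≡ j → (Σ (Fin (C (j′ j₁))) λ l → Σ (Fin A) λ a → kv j₁ l a ∈ D × KNbr j₁ l a (u i (vertexAt o o<4))) →
               Σ (Fin (C r)) λ l → Σ (Fin A) λ a → kv j l a ∈ D × KNbr j l a (u i (vertexAt o o<4))
    relocate refl found = found
    locate : (Σ (Fin (F * m)) λ j₁ → Σ (Fin (C (j′ j₁))) λ l → Σ (Fin A) λ a → kv j₁ l a ∈ D × KNbr j₁ l a (u i (vertexAt o o<4))) →
            Σ (Fin (C r)) λ l → Σ (Fin A) λ a → kv j l a ∈ D × KNbr j l a (u i (vertexAt o o<4))
    locate (j₁ , l , a , k∈D , nbr) = relocate (kNbr-in-block o (≤-pred o<4) (toℕ-vertexAt o o<4) j₁ l a nbr) (l , a , k∈D , nbr)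

  _≟²_ : ∀ (la la′ : Fin (C r) × Fin A) → Dec (la ≡ la′)
  _≟²_ = Data.Product.Properties.≡-dec Finₚ._≟_ Finₚ._≟_

  K▷K : ∀ l a l′ a′ → Dominates (kv j l a) (kv j l′ a′)
  K▷K l a l′ a′ with (l , a) ≟² (l′ , a′)
  ... | yes refl = inj₁ refl
  ... | no ≢ = inj₂ (inj₁ (Kcl j l a l′ a′ λ { (refl , refl) → ≢ refl }))

  L▷L : ∀ l a l′ a′ → Dominates (lv j l a) (lv j l′ a′)
  L▷L l a l′ a′ with (l , a) ≟² (l′ , a′)
  ... | yes refl = inj₁ refl
  ... | no ≢ = inj₂ (inj₁ (Lcl j l a l′ a′ λ { (refl , refl) → ≢ refl }))

  L▷w : ∀ l a → Dominates (lv j l a) (w j)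
  L▷w l a = inj₂ (inj₂ (wL j l a))

  w▷L : ∀ l a → Dominates (w j) (lv j l a)
  w▷L l a = inj₂ (inj₁ (wL j l a))

  L▷K : ∀ l a → Dominates (lv j l a) (kv j l a)
  L▷K l a = inj₂ (inj₂ (match j l a))

  L▷K-cross : ∀ l a l′ a′ → l′ ≢ l → Dominates (lv j l a) (kv j l′ a′)
  L▷K-cross l a l′ a′ l′≢l = inj₂ (inj₂ (KL j l′ a′ l a l′≢l))

  u▷K : ∀ l a s t o → InPair (acc r l s) o → toℕ t ≡ 4 * J + o + 3 → Dominates (u (scope r s) t) (kv j l a)
  u▷K l a s t o inPair t≡ = inj₂ (inj₁ (pair j l a s t o inPair t≡))

  u-injective : ∀ {i i′ t t′} → u i t ≡ u i′ t′ → i ≡ i′ × t ≡ t′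
  u-injective refl = refl , refl

  kv-injective : ∀ {l l′ a a′} → kv j l a ≡ kv j l′ a′ → (l , a) ≡ (l′ , a′)
  kv-injective refl = refl

  lv-injective : ∀ {l l′ a a′} → lv j l a ≡ lv j l′ a′ → (l , a) ≡ (l′ , a′)
  lv-injective refl = refl

  NoPrivates : Set
  NoPrivates = ∀ i o → o < 4 → kPrivateOn i (blockPos J o) ≡ false

  privates≡0 : NoPrivates → privates ≡ 0
  privates≡0 none = sum-zero _ λ i → trans (sumTo-cong< 4 λ o o<4 → cong bit (none i o o<4)) (sum-const 4 0)

  noPrivates-if : (∀ i o (o<4 : o < 4) → ¬ KPrivateHere i (vertexAt o o<4)) → NoPrivates
  noPrivates-if never i o o<4 = Boolₚ.¬-not λ kp → kPrivate-here i o o<4 kp (never i o o<4)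

  w∈D⇒L∉D : w j ∈ D → ∀ l a → ¬ lv j l a ∈ D
  w∈D⇒L∉D w∈D l a l∈D = private-neighbour (w j) w∈D noPrivate
    where
    noPrivate : ¬ Σ V (PrivateNeighbour (w j))
    noPrivate (_ , inj₁ refl , priv) with () ← priv _ l∈D (L▷w l a)
    noPrivate (_ , inj₂ adj , priv) with wNbr (adj-sym adj)
    ... | l′ , a′ , refl with () ← priv _ l∈D (L▷L l a l′ a′)

  w∉D⇒L∈D : ¬ w j ∈ D → Σ (Fin (C r)) λ l → Σ (Fin A) λ a → lv j l a ∈ D
  w∉D⇒L∈D w∉D with dominator (w j)
  ... | _ , z∈D , inj₁ refl = contradiction z∈D w∉D
  ... | _ , z∈D , inj₂ adj with wNbr adj
  ...   | l , a , refl = l , a , z∈D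

  K∈D⇒noPrivates : ∀ l₀ a₀ → kv j l₀ a₀ ∈ D → NoPrivates
  K∈D⇒noPrivates l₀ a₀ k∈D = noPrivates-if never
    where
    never : ∀ i o (o<4 : o < 4) → ¬ KPrivateHere i (vertexAt o o<4)
    never i o o<4 (l , a , _ , _ , priv) with () ← priv _ k∈D (K▷K l₀ a₀ l a)

  K∉D⇒noKDominated : (∀ l a → ¬ kv j l a ∈ D) → ∀ i o → o < 4 → kDominatedOn i (blockPos J o) ≡ false
  K∉D⇒noKDominated noK i o o<4 = Boolₚ.¬-not λ kd → let (l , a , k∈D , _) = kDominated-here i o o<4 kd in noK l a k∈D

  module TwoClasses (l₁ : Fin (C r)) (a₁ : Fin A) (l₂ : Fin (C r)) (a₂ : Fin A)
                    (l₁∈D : lv j l₁ a₁ ∈ D) (l₂∈D : lv j l₂ a₂ ∈ D) (l₁≢l₂ : l₁ ≢ l₂) where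

    K-covered : ∀ l a → Dominates (lv j l₁ a₁) (kv j l a) ⊎ Dominates (lv j l₂ a₂) (kv j l a)
    K-covered l a with l Finₚ.≟ l₁
    ... | no l≢l₁ = inj₁ (L▷K-cross l₁ a₁ l a l≢l₁)
    ... | yes refl = inj₂ (L▷K-cross l₂ a₂ l a l₁≢l₂)

    K∉D : ∀ l a → ¬ kv j l a ∈ D
    K∉D l a k∈D = private-neighbour (lv j l₁ a₁) l₁∈D noPrivate
      where
      other : ∀ {y} → Dominates (lv j l₂ a₂) y → ¬ PrivateNeighbour (lv j l₁ a₁) y
      other l₂▷y (_ , priv) = l₁≢l₂ (sym (cong proj₁ (lv-injective (priv _ l₂∈D l₂▷y))))
      noPrivate : ¬ Σ V (PrivateNeighbour (lv j l₁ a₁))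
      noPrivate (_ , p@(inj₁ refl , _)) = other (L▷L l₂ a₂ l₁ a₁) p
      noPrivate (_ , p@(inj₂ adj , priv)) with lNbr (adj-sym adj)
      ... | clique l′ a′ _ = other (L▷L l₂ a₂ l′ a′) p
      ... | hub = other (L▷w l₂ a₂) p
      ... | matched with () ← priv _ k∈D (K▷K l a l₁ a₁)
      ... | cross l′ a′ _ with () ← priv _ k∈D (K▷K l a l′ a′)

    onlyTwo : ∀ l a → lv j l a ∈ D → (l₁ , a₁) ≡ (l , a) ⊎ (l₂ , a₂) ≡ (l , a)
    onlyTwo l a l∈D with (l₁ , a₁) ≟² (l , a) | (l₂ , a₂) ≟² (l , a)
    ... | yes e | _ = inj₁ e
    ... | no _ | yes e = inj₂ e
    ... | no ≢₁ | no ≢₂ = contradiction noPrivate (private-neighbour (lv j l a) l∈D)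
      where
      viaCover : ∀ {y} → Dominates (lv j l₁ a₁) y ⊎ Dominates (lv j l₂ a₂) y → ¬ PrivateNeighbour (lv j l a) y
      viaCover (inj₁ l₁▷y) (_ , priv) = ≢₁ (lv-injective (priv _ l₁∈D l₁▷y))
      viaCover (inj₂ l₂▷y) (_ , priv) = ≢₂ (lv-injective (priv _ l₂∈D l₂▷y))
      noPrivate : ¬ Σ V (PrivateNeighbour (lv j l a))
      noPrivate (_ , p@(inj₁ refl , _)) = viaCover (inj₁ (L▷L l₁ a₁ l a)) p
      noPrivate (_ , p@(inj₂ adj , _)) with lNbr (adj-sym adj)
      ... | clique l′ a′ _ = viaCover (inj₁ (L▷L l₁ a₁ l′ a′)) p
      ... | hub = viaCover (inj₁ (L▷w l₁ a₁)) p
      ... | matched = viaCover (K-covered l a) p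
      ... | cross l′ a′ _ = viaCover (K-covered l′ a′) p

    noPrivates : NoPrivates
    noPrivates = noPrivates-if never
      where
      never : ∀ i o (o<4 : o < 4) → ¬ KPrivateHere i (vertexAt o o<4)
      never i o o<4 (l , a , _ , _ , priv) with K-covered l a
      ... | inj₁ l₁▷k with () ← priv _ l₁∈D l₁▷k
      ... | inj₂ l₂▷k with () ← priv _ l₂∈D l₂▷k

  u▷K-sameClass : ∀ {l a′ i t} → KNbr j l a′ (u i t) → ∀ a → Dominates (u i t) (kv j l a)
  u▷K-sameClass (path s t o inPair t≡) a = u▷K _ a s t o inPair t≡

  1<A : 1 < A
  1<A = m≤n+m 2 (4 * q)

  anotherIndex : (a : Fin A) → Σ (Fin A) λ a′ → a′ ≢ a
  anotherIndex a with toℕ a ≟ 0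
  ... | yes a≡0 = fromℕ< 1<A , λ e → 1+n≢0 (trans (sym (Finₚ.toℕ-fromℕ< 1<A)) (trans (cong toℕ e) a≡0))
  ... | no a≢0 = fromℕ< 0<A , λ e → a≢0 (trans (sym (cong toℕ e)) (Finₚ.toℕ-fromℕ< 0<A))
    where
    0<A : 0 < A
    0<A = ≤-trans (s≤s z≤n) 1<A

  module OneClass (l₁ : Fin (C r)) (a₁ : Fin A) (l₁∈D : lv j l₁ a₁ ∈ D)
                  (sameClass : ∀ l a → lv j l a ∈ D → l ≡ l₁) where

    onlyOne : ∀ l₀ a₀ → kv j l₀ a₀ ∈ D → ∀ l a → lv j l a ∈ D → (l₁ , a₁) ≡ (l , a)
    onlyOne l₀ a₀ k∈D l a l∈D with sameClass l a l∈D
    ... | refl with (l₁ , a₁) ≟² (l , a)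
    ...   | yes e = e
    ...   | no ≢ = contradiction noPrivate (private-neighbour (lv j l a) l∈D)
      where
      viaL₁ : ∀ {y} → Dominates (lv j l₁ a₁) y → ¬ PrivateNeighbour (lv j l a) y
      viaL₁ l₁▷y (_ , priv) = ≢ (lv-injective (priv _ l₁∈D l₁▷y))
      noPrivate : ¬ Σ V (PrivateNeighbour (lv j l a))
      noPrivate (_ , p@(inj₁ refl , _)) = viaL₁ (L▷L l₁ a₁ l a) p
      noPrivate (_ , p@(inj₂ adj , priv)) with lNbr (adj-sym adj)
      ... | clique l′ a′ _ = viaL₁ (L▷L l₁ a₁ l′ a′) p
      ... | hub = viaL₁ (L▷w l₁ a₁) p
      ... | matched with () ← priv _ k∈D (K▷K l₀ a₀ l a)
      ... | cross l′ a′ _ with () ← priv _ k∈D (K▷K l₀ a₀ l′ a′)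

    KPrivateInClass : Fin n → Fin pathLength → Set
    KPrivateInClass i t = Σ (Fin A) λ a → ¬ lv j l₁ a ∈ D × KNbr j l₁ a (u i t) × PrivateNeighbour (u i t) (kv j l₁ a)

    inClass : ∀ {i t} → KPrivateHere i t → KPrivateInClass i t
    inClass (l , a , nbr , dom , priv) with l Finₚ.≟ l₁
    ... | no l≢l₁ with () ← priv _ l₁∈D (L▷K-cross l₁ a₁ l a l≢l₁)
    ... | yes refl with lv j l₁ a ∈? D
    ...   | yes l∈D with () ← priv _ l∈D (L▷K l₁ a)
    ...   | no l∉D = a , l∉D , nbr , dom , priv

    noPrivates-if-full : (∀ a → lv j l₁ a ∈ D) → NoPrivates
    noPrivates-if-full full = noPrivates-if λ i o o<4 p → let (a , l∉D , _) = inClass p in l∉D (full a)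

    privates-unique : ∀ i o (o<4 : o < 4) i′ o′ (o′<4 : o′ < 4) →
      kPrivateOn i (blockPos J o) ≡ true → kPrivateOn i′ (blockPos J o′) ≡ true → i ≡ i′ × o ≡ o′
    privates-unique i o o<4 i′ o′ o′<4 kp kp′ =
      decidable-stable ((i Finₚ.≟ i′) ×-dec (o ≟ o′)) λ differ →
        kPrivate-here i o o<4 kp λ p → kPrivate-here i′ o′ o′<4 kp′ λ p′ →
          let (a , _ , _ , _ , priv) = inClass p
              (_ , _ , nbr′ , _) = inClass p′
          in differ (same (priv _ (center∈D i′ o′ o′<4 kp′) (u▷K-sameClass nbr′ a)))
      where
      center∈D : ∀ i o o<4 → kPrivateOn i (blockPos J o) ≡ true → u i (vertexAt o o<4) ∈ D
      center∈D i o o<4 kp = kPrivate⇒∈D i (vertexAt o o<4) (subst (λ x → kPrivateOn i x ≡ true) (sym (toℕ-vertexAt o o<4)) kp)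
      same : u i′ (vertexAt o′ o′<4) ≡ u i (vertexAt o o<4) → i ≡ i′ × o ≡ o′
      same e = sym (proj₁ (u-injective e)) , sym (+-cancelʳ-≡ 3 o′ o (+-cancelʳ-≡ (J * 4) (o′ + 3) (o + 3)
                 (trans (sym (toℕ-vertexAt o′ o′<4)) (trans (cong toℕ (proj₂ (u-injective e))) (toℕ-vertexAt o o<4)))))

    agrees-if-full : (∀ a → lv j l₁ a ∈ D) → ∀ s → Agrees l₁ s
    agrees-if-full full s = pairFree (inj₁ refl) , pairFree (inj₂ refl)
      where
      a′ : Fin A
      a′ = proj₁ (anotherIndex a₁)
      a′≢a₁ : a′ ≢ a₁
      a′≢a₁ = proj₂ (anotherIndex a₁)
      viaA′ : ∀ {y} → Dominates (lv j l₁ a′) y → ¬ PrivateNeighbour (lv j l₁ a₁) y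
      viaA′ ▷y (_ , priv) = a′≢a₁ (cong proj₂ (lv-injective (priv _ (full a′) ▷y)))
      pairFree : ∀ {o} → InPair (acc r l₁ s) o → pathBit (scope r s) (4 * J + o + 3) ≡ false
      pairFree {o} inPair = Boolₚ.¬-not λ bit-t →
        let (t , t≡ , t∈D) = pathBit-true (scope r s) _ bit-t in
        private-neighbour (lv j l₁ a₁) l₁∈D (noPrivate t t≡ t∈D)
        where
        noPrivate : ∀ t → toℕ t ≡ 4 * J + o + 3 → u (scope r s) t ∈ D → ¬ Σ V (PrivateNeighbour (lv j l₁ a₁))
        noPrivate t t≡ t∈D (_ , p@(inj₁ refl , _)) = viaA′ (L▷L l₁ a′ l₁ a₁) p
        noPrivate t t≡ t∈D (_ , p@(inj₂ adj , priv)) with lNbr (adj-sym adj)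
        ... | clique l′ a″ _ = viaA′ (L▷L l₁ a′ l′ a″) p
        ... | hub = viaA′ (L▷w l₁ a′) p
        ... | cross l′ a″ l′≢l₁ = viaA′ (L▷K-cross l₁ a′ l′ a″ l′≢l₁) p
        ... | matched with () ← priv _ t∈D (u▷K l₁ a₁ s t o inPair t≡)


    privates≤1 : privates ≤ 1
    privates≤1 = sum²≤1 (λ i o → bit (kPrivateOn i (blockPos J (toℕ o)))) (λ _ _ → bit≤1 _) unique
      where
      unique : ∀ i o i′ o′ → bit (kPrivateOn i (blockPos J (toℕ o))) ≡ 1 → bit (kPrivateOn i′ (blockPos J (toℕ o′))) ≡ 1 →
               i ≡ i′ × o ≡ o′
      unique i o i′ o′ p p′ =
        let (i≡i′ , o≡o′) = privates-unique i (toℕ o) (Finₚ.toℕ<n o) i′ (toℕ o′) (Finₚ.toℕ<n o′) (bit≡1⇒true p) (bit≡1⇒true p′)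
        in i≡i′ , Finₚ.toℕ-injective o≡o′

  inPair? : ∀ v o → Dec (InPair v o)
  inPair? v o = (o ≟ proj₁ (pairOf v)) ⊎-dec (o ≟ proj₂ (pairOf v))

  Serves : Fin (C r) → Fin A → Fin q → ℕ → Set
  Serves l a s o = kv j l a ∈ D × InPair (acc r l s) o ×
    (∀ l′ a′ → (l′ , a′) ≢ (l , a) → kv j l′ a′ ∈ D → ¬ InPair (acc r l′ s) o)

  serves? : ∀ l a s o → Dec (Serves l a s o)
  serves? l a s o = (kv j l a ∈? D) ×-dec inPair? (acc r l s) o ×-dec
    Finₚ.all? λ l′ → Finₚ.all? λ a′ → ¬? ((l′ , a′) ≟² (l , a)) →-dec (kv j l′ a′ ∈? D) →-dec ¬? (inPair? (acc r l′ s) o)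

  serves-unique : ∀ s o l a l′ a′ → Serves l a s o → Serves l′ a′ s o → (l , a) ≡ (l′ , a′)
  serves-unique s o l a l′ a′ (_ , _ , others) (k′∈D , inPair′ , _) with (l , a) ≟² (l′ , a′)
  ... | yes e = e
  ... | no ≢ = contradiction inPair′ (others l′ a′ (≢ ∘ sym) k′∈D)

  servers≤1 : ∀ s o → sum (λ l → sum λ a → bit (does (serves? l a s o))) ≤ 1
  servers≤1 s o = sum²≤1 _ (λ _ _ → bit≤1 _) unique
    where
    unique : ∀ l a l′ a′ → bit (does (serves? l a s o)) ≡ 1 → bit (does (serves? l′ a′ s o)) ≡ 1 → l ≡ l′ × a ≡ a′
    unique l a l′ a′ p p′ with serves-unique s o l a l′ a′ (bit-does≡1 (serves? l a s o) p) (bit-does≡1 (serves? l′ a′ s o) p′)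
    ... | refl = refl , refl

  UniqueK : Set
  UniqueK = Σ (Fin (C r)) λ l → Σ (Fin A) λ a → kv j l a ∈ D × (∀ l′ a′ → (l′ , a′) ≢ (l , a) → ¬ kv j l′ a′ ∈ D)

  uniqueK? : Dec UniqueK
  uniqueK? = Finₚ.any? λ l → Finₚ.any? λ a → (kv j l a ∈? D) ×-dec
    Finₚ.all? λ l′ → Finₚ.all? λ a′ → ¬? ((l′ , a′) ≟² (l , a)) →-dec ¬? (kv j l′ a′ ∈? D)

  countK≤1 : UniqueK → countK ≤ 1
  countK≤1 (l , a , _ , others) = sum²≤1 _ (λ _ _ → bit≤1 _) unique
    where
    inUnique : ∀ l′ a′ → bit (kIn l′ a′) ≡ 1 → (l′ , a′) ≡ (l , a)
    inUnique l′ a′ p with (l′ , a′) ≟² (l , a)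
    ... | yes e = e
    ... | no ≢ = contradiction (inD-true⇒∈ (bit≡1⇒true p)) (others l′ a′ ≢)
    unique : ∀ l₁ a₁ l₂ a₂ → bit (kIn l₁ a₁) ≡ 1 → bit (kIn l₂ a₂) ≡ 1 → l₁ ≡ l₂ × a₁ ≡ a₂
    unique l₁ a₁ l₂ a₂ p₁ p₂ with inUnique l₁ a₁ p₁ | inUnique l₂ a₂ p₂
    ... | refl | refl = refl , refl

  services : Fin (C r) → Fin A → ℕ
  services l a = sum λ s → sumTo 4 λ o → bit (does (serves? l a s o))

  serves⇒services-pos : ∀ {l a s o} → o ≤ 3 → Serves l a s o → 1 ≤ services l a
  serves⇒services-pos {l} {a} {s} {o} o≤3 service = begin
    1                                         ≡⟨ cong bit (dec-true (serves? l a s o) service) ⟨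
    bit (does (serves? l a s o))              ≤⟨ sumTo-term 4 (λ o → bit (does (serves? l a s o))) o (s≤s o≤3) ⟩
    sumTo 4 (λ o → bit (does (serves? l a s o))) ≤⟨ term≤sum (λ s → sumTo 4 λ o → bit (does (serves? l a s o))) s ⟩
    services l a ∎
    where open ≤-Reasoning

  -- A K-vertex of D that is not alone in K has its private neighbour at one of the 4q path positions (s, o)
  -- of the clause, and no position serves two of them.
  module KBound (z : V) (z∈D : z ∈ D) (z▷L : ∀ l a → Dominates z (lv j l a)) (z≢K : ∀ l a → z ≢ kv j l a) where

    K∈D⇒serves : ¬ UniqueK → ∀ l a → kv j l a ∈ D → 1 ≤ services l a
    K∈D⇒serves notUnique l a k∈D = decidable-stable (1 ≤? _) λ noService →
      private-neighbour (kv j l a) k∈D (noPrivate noService)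
      where
      second : Σ (Fin (C r)) λ l₂ → Σ (Fin A) λ a₂ → (l₂ , a₂) ≢ (l , a) × kv j l₂ a₂ ∈ D
      second with Finₚ.any? (λ l₂ → Finₚ.any? λ a₂ → ¬? ((l₂ , a₂) ≟² (l , a)) ×-dec (kv j l₂ a₂ ∈? D))
      ... | yes found = found
      ... | no none = contradiction (l , a , k∈D , λ l₂ a₂ ≢ k₂∈D → none (l₂ , a₂ , ≢ , k₂∈D)) notUnique
      viaSecond : ∀ {y} → Dominates (kv j (proj₁ second) (proj₁ (proj₂ second))) y → ¬ PrivateNeighbour (kv j l a) y
      viaSecond ▷y (_ , priv) = let (_ , _ , ≢ , k₂∈D) = second in ≢ (kv-injective (priv _ k₂∈D ▷y))
      noPrivate : ¬ (1 ≤ services l a) → ¬ Σ V (PrivateNeighbour (kv j l a))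
      noPrivate _ (_ , p@(inj₁ refl , _)) = viaSecond (K▷K _ _ l a) p
      noPrivate noService (_ , p@(inj₂ adj , priv)) with kNbr (adj-sym adj)
      ... | clique l′ a′ _ = viaSecond (K▷K _ _ l′ a′) p
      ... | matched = z≢K l a (priv z z∈D (z▷L l a))
      ... | cross l′ a′ _ = z≢K l a (priv z z∈D (z▷L l′ a′))
      ... | path s t o inPair t≡ = noService (serves⇒services-pos (inPair≤3 (acc r l s) o inPair)
              (k∈D , inPair , λ l′ a′ ≢ k′∈D inPair′ → ≢ (kv-injective (priv _ k′∈D (inj₂ (inj₂ (pair j l′ a′ s t o inPair′ t≡)))))))

    countK-bound : countK ≤ 1 ⊎ countK ≤ 4 * q
    countK-bound = byUniqueness uniqueK?
      where
      byUniqueness : Dec UniqueK → countK ≤ 1 ⊎ countK ≤ 4 * q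
      byUniqueness (yes unique) = inj₁ (countK≤1 unique)
      byUniqueness (no notUnique) = inj₂ (begin
          countK                                       ≤⟨ sum-mono (λ l → sum-mono λ a → bound l a) ⟩
          sum (λ l → sum λ a → sum λ s → sum λ o → f l a s o) ≡⟨ sum-cong-≗ (λ l → ∑-comm (λ a s → sum (f l a s))) ⟩
          sum (λ l → sum λ s → sum λ a → sum λ o → f l a s o) ≡⟨ ∑-comm (λ l s → sum λ a → sum (f l a s)) ⟩
          sum (λ s → sum λ l → sum λ a → sum λ o → f l a s o) ≡⟨ sum-cong-≗ (λ s → sum-cong-≗ λ l → ∑-comm (λ a o → f l a s o)) ⟩
          sum (λ s → sum λ l → sum λ o → sum λ a → f l a s o) ≡⟨ sum-cong-≗ (λ s → ∑-comm (λ l o → sum λ a → f l a s o)) ⟩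
          sum (λ s → sum λ o → sum λ l → sum λ a → f l a s o) ≤⟨ sum-mono (λ s → sum-mono {4} {g = λ _ → 1} λ o → servers≤1 s (toℕ o)) ⟩
          sum {q} (λ _ → 4)                            ≡⟨ sum-const q 4 ⟩
          q * 4                                        ≡⟨ *-comm q 4 ⟩
          4 * q ∎)
        where
        open ≤-Reasoning
        f : Fin (C r) → Fin A → Fin q → Fin 4 → ℕ
        f l a s o = bit (does (serves? l a s (toℕ o)))
        bound : ∀ l a → bit (kIn l a) ≤ services l a
        bound l a = bit≤ (kIn l a) λ k∈D → K∈D⇒serves notUnique l a (inD-true⇒∈ k∈D)

  privates≤4q : privates ≤ 4 * q
  privates≤4q = begin
      privates                                        ≤⟨ sum-mono (λ i → sumTo-mono< 4 {g = λ _ → occurrences i} (bound i)) ⟩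
      sum (λ i → sum {4} λ _ → occurrences i)         ≡⟨ sum-cong-≗ (λ i → sum-const 4 (occurrences i)) ⟩
      sum (λ i → 4 * occurrences i)                   ≡⟨ *-distribˡ-sum 4 occurrences ⟨
      4 * sum occurrences                             ≡⟨ cong (4 *_) (∑-comm (λ i s → δ (scope r s) i)) ⟩
      4 * sum (λ s → sum (δ (scope r s)))              ≡⟨ cong (4 *_) (trans (sum-cong-≗ (λ s → sum-δ (scope r s))) (trans (sum-const q 1) (*-identityʳ q))) ⟩
      4 * q ∎
    where
    open ≤-Reasoning
    occurrences : Fin n → ℕ
    occurrences i = sum λ s → δ (scope r s) i
    inScope : ∀ {i t l a} → KNbr j l a (u i t) → Σ (Fin q) λ s → scope r s ≡ i
    inScope (path s _ _ _ _) = s , refl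
    bound : ∀ i o → o < 4 → bit (kPrivateOn i (blockPos J o)) ≤ occurrences i
    bound i o o<4 = bit≤ _ λ kp → decidable-stable (1 ≤? _) λ none →
      kPrivate-here i o o<4 kp λ (_ , _ , nbr , _) → let (s , s≡i) = inScope nbr in
        none (≤-trans (≤-reflexive (sym (cong bit (dec-true (scope r s Finₚ.≟ i) s≡i)))) (term≤sum (λ s → δ (scope r s) i) s))


  size : ℕ
  size = countK + countL + bit wIn

  countK≡0 : (∀ l a → ¬ kv j l a ∈ D) → countK ≡ 0
  countK≡0 none = sum-zero _ λ l → sum-zero _ λ a → cong bit (∉⇒inD-false (none l a))

  countL≡0 : (∀ l a → ¬ lv j l a ∈ D) → countL ≡ 0
  countL≡0 none = sum-zero _ λ l → sum-zero _ λ a → cong bit (∉⇒inD-false (none l a))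

  countL-oneClass : ∀ l₁ → (∀ l a → lv j l a ∈ D → l ≡ l₁) → countL ≡ sum (λ a → bit (lIn l₁ a))
  countL-oneClass l₁ sameClass = sum-single _ l₁ λ l l₁≢l →
    sum-zero _ λ a → cong bit (Boolₚ.¬-not λ l∈D → l₁≢l (sym (sameClass l a (inD-true⇒∈ l∈D))))

  clean⇒bad≡0 : Clean → bad ≡ 0
  clean⇒bad≡0 clean = cong (bit ∘ not) (dec-true clean? clean)

  kUses≡0 : NoPrivates → (∀ i o → o < 4 → kDominatedOn i (blockPos J o) ≡ false) → kUses ≡ 0
  kUses≡0 noP noD = sum-zero _ λ i → trans (sumTo-cong< 4 λ o o<4 → cong₂ (λ x y → bit (x ∨ y)) (noP i o o<4) (noD i o o<4)) (sum-const 4 0)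

  q≡0⇒bad≡0 : Fin (C r) → q ≡ 0 → bad ≡ 0
  q≡0⇒bad≡0 l refl = clean⇒bad≡0 ((l , λ ()) , kUses≡0 (noPrivates-if noScope) noDominated)
    where
    noScope : ∀ i o (o<4 : o < 4) → ¬ KPrivateHere i (vertexAt o o<4)
    noScope i o o<4 (_ , _ , path () _ _ _ _ , _)
    noDominated : ∀ i o → o < 4 → kDominatedOn i (blockPos J o) ≡ false
    noDominated i o o<4 = Boolₚ.¬-not λ kd → impossible (kDominated-here i o o<4 kd)
      where
      impossible : ¬ (Σ (Fin (C r)) λ l → Σ (Fin A) λ a → kv j l a ∈ D × KNbr j l a (u i (vertexAt o o<4)))
      impossible (_ , _ , _ , path () _ _ _ _)

  Budget : Set
  Budget = 2 * size + privates + bad ≤ 2 * A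

  budget : ∀ x y z → size ≤ x → privates ≤ y → bad ≤ z → 2 * x + y + z ≤ 2 * A → Budget
  budget x y z size≤ privates≤ bad≤ fits = ≤-trans (+-mono-≤ (+-mono-≤ (*-monoʳ-≤ 2 size≤) privates≤) bad≤) fits

  budget-few : Fin (C r) → size ≤ 2 → privates ≡ 0 → Budget
  budget-few l size≤2 privates≡0 = budget 2 0 bad size≤2 (≤-reflexive privates≡0) ≤-refl (fits-few q bad (bit≤1 _) (q≡0⇒bad≡0 l))

  budget-large : size ≤ 4 * q + 1 → privates ≤ 1 → Budget
  budget-large size≤ privates≤1 = budget (4 * q + 1) 1 1 size≤ privates≤1 (bit≤1 _) (fits-large q)

  size≤ : ∀ {x y} → countK ≤ x → countL + bit wIn ≤ y → size ≤ x + y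
  size≤ countK≤ rest≤ = ≤-trans (≤-reflexive (+-assoc countK countL _)) (+-mono-≤ countK≤ rest≤)

  budget-K : ∀ l₀ a₀ → kv j l₀ a₀ ∈ D → ∀ z → z ∈ D → (∀ l a → Dominates z (lv j l a)) → (∀ l a → z ≢ kv j l a) →
             countL + bit wIn ≤ 1 → Budget
  budget-K l₀ a₀ k∈D z z∈D z▷L z≢K rest≤1 =
    [ (λ countK≤1 → budget-few l₀ (size≤ countK≤1 rest≤1) noPrivates)
    , (λ countK≤4q → budget-large (size≤ countK≤4q rest≤1) (≤-trans (≤-reflexive noPrivates) z≤n))
    ]′ (KBound.countK-bound z z∈D z▷L z≢K)
    where
    noPrivates : privates ≡ 0
    noPrivates = privates≡0 (K∈D⇒noPrivates l₀ a₀ k∈D)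

  budget-w∈D : w j ∈ D → Budget
  budget-w∈D w∈D = byK (Finₚ.any? λ l → Finₚ.any? λ a → kv j l a ∈? D)
    where
    noL : countL + bit wIn ≡ bit wIn
    noL = cong (_+ bit wIn) (countL≡0 (w∈D⇒L∉D w∈D))
    byK : Dec (Σ (Fin (C r)) λ l → Σ (Fin A) λ a → kv j l a ∈ D) → Budget
    byK (yes (l₀ , a₀ , k∈D)) = budget-K l₀ a₀ k∈D (w j) w∈D w▷L (λ _ _ ()) (≤-trans (≤-reflexive noL) (bit≤1 wIn))
    byK (no noK) = budget 1 (4 * q) 1 size≤1 privates≤4q (bit≤1 _) (fits-hub q)
      where
      size≤1 : size ≤ 1
      size≤1 = ≤-trans (≤-reflexive (trans (+-assoc countK countL _) (cong₂ _+_ (countK≡0 λ l a k∈D → noK (l , a , k∈D)) noL)))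
                       (bit≤1 wIn)

  budget-twoClasses : ∀ l₁ a₁ l₂ a₂ → lv j l₁ a₁ ∈ D → lv j l₂ a₂ ∈ D → l₁ ≢ l₂ → wIn ≡ false → Budget
  budget-twoClasses l₁ a₁ l₂ a₂ l₁∈D l₂∈D l₁≢l₂ w∉D = budget-few l₁ (size≤ (≤-reflexive (countK≡0 K∉D)) countL≤2) (privates≡0 noPrivates)
    where
    open TwoClasses l₁ a₁ l₂ a₂ l₁∈D l₂∈D l₁≢l₂
    δ² : Fin (C r) → Fin A → Fin (C r) → Fin A → ℕ
    δ² l₀ a₀ l a = δ l₀ l * δ a₀ a
    pointwise : ∀ l a → bit (lIn l a) ≤ δ² l₁ a₁ l a + δ² l₂ a₂ l a
    pointwise l a = bit≤ _ λ l∈D → atOneOf (onlyTwo l a (inD-true⇒∈ l∈D))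
      where
      atOneOf : (l₁ , a₁) ≡ (l , a) ⊎ (l₂ , a₂) ≡ (l , a) → 1 ≤ δ² l₁ a₁ l a + δ² l₂ a₂ l a
      atOneOf (inj₁ refl) = ≤-trans (≤-reflexive (sym (cong₂ _*_ (δ-refl l) (δ-refl a)))) (m≤m+n _ _)
      atOneOf (inj₂ refl) = ≤-trans (≤-reflexive (sym (cong₂ _*_ (δ-refl l) (δ-refl a)))) (m≤n+m _ _)
    countL≤2 : countL + bit wIn ≤ 2
    countL≤2 = begin
      countL + bit wIn                                         ≡⟨ cong (λ b → countL + bit b) w∉D ⟩
      countL + 0                                               ≡⟨ +-identityʳ countL ⟩
      countL                                                   ≤⟨ sum-mono (λ l → sum-mono λ a → pointwise l a) ⟩
      sum (λ l → sum λ a → δ² l₁ a₁ l a + δ² l₂ a₂ l a)         ≡⟨ sum-cong-≗ (λ l → ∑-distrib-+ (δ² l₁ a₁ l) (δ² l₂ a₂ l)) ⟩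
      sum (λ l → sum (δ² l₁ a₁ l) + sum (δ² l₂ a₂ l))           ≡⟨ ∑-distrib-+ (λ l → sum (δ² l₁ a₁ l)) (λ l → sum (δ² l₂ a₂ l)) ⟩
      sum (λ l → sum (δ² l₁ a₁ l)) + sum (λ l → sum (δ² l₂ a₂ l)) ≡⟨ cong₂ _+_ (sum²-δ l₁ a₁) (sum²-δ l₂ a₂) ⟩
      2 ∎
      where open ≤-Reasoning

  module _ (l₁ : Fin (C r)) (a₁ : Fin A) (l₁∈D : lv j l₁ a₁ ∈ D)
           (sameClass : ∀ l a → lv j l a ∈ D → l ≡ l₁) (w∉D : wIn ≡ false) where
    open OneClass l₁ a₁ l₁∈D sameClass

    private
      noHub : countL + bit wIn ≡ countL
      noHub = trans (cong (λ b → countL + bit b) w∉D) (+-identityʳ countL)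

      size≡classCount : (∀ l a → ¬ kv j l a ∈ D) → size ≡ sum (λ a → bit (lIn l₁ a))
      size≡classCount noK = trans (cong (λ x → x + countL + bit wIn) (countK≡0 noK)) (trans noHub (countL-oneClass l₁ sameClass))

    budget-oneClass-K : ∀ l₀ a₀ → kv j l₀ a₀ ∈ D → Budget
    budget-oneClass-K l₀ a₀ k∈D = budget-K l₀ a₀ k∈D (lv j l₁ a₁) l₁∈D (L▷L l₁ a₁) (λ _ _ ()) (≤-trans (≤-reflexive noHub) countL≤1)
      where
      countL≤1 : countL ≤ 1
      countL≤1 = sum²≤1 _ (λ _ _ → bit≤1 _) unique
        where
        unique : ∀ l a l′ a′ → bit (lIn l a) ≡ 1 → bit (lIn l′ a′) ≡ 1 → l ≡ l′ × a ≡ a′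
        unique l a l′ a′ p p′
          with onlyOne l₀ a₀ k∈D l a (inD-true⇒∈ (bit≡1⇒true p)) | onlyOne l₀ a₀ k∈D l′ a′ (inD-true⇒∈ (bit≡1⇒true p′))
        ... | refl | refl = refl , refl

    budget-oneClass-partial : (∀ l a → ¬ kv j l a ∈ D) → ∀ a → ¬ lv j l₁ a ∈ D → Budget
    budget-oneClass-partial noK a l∉D = budget-large size≤4q+1 privates≤1
      where
      size≤4q+1 : size ≤ 4 * q + 1
      size≤4q+1 = ≤-pred (begin
        suc size                       ≡⟨ cong suc (size≡classCount noK) ⟩
        suc (sum λ a → bit (lIn l₁ a)) ≤⟨ sum<card (λ a → bit (lIn l₁ a)) a (λ _ → bit≤1 _) (cong bit (∉⇒inD-false l∉D)) ⟩
        4 * q + 2                      ≡⟨ +-suc (4 * q) 1 ⟩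
        suc (4 * q + 1) ∎)
        where open ≤-Reasoning

    budget-oneClass-full : (∀ l a → ¬ kv j l a ∈ D) → (∀ a → lv j l₁ a ∈ D) → Budget
    budget-oneClass-full noK full =
      budget A 0 0 size≤A (≤-reflexive noPrivates) (≤-reflexive bad≡0) (≤-reflexive (trans (+-identityʳ _) (+-identityʳ _)))
      where
      size≤A : size ≤ A
      size≤A = ≤-trans (≤-reflexive (size≡classCount noK)) (sum≤card _ λ _ → bit≤1 _)
      noPrivates : privates ≡ 0
      noPrivates = privates≡0 (noPrivates-if-full full)
      bad≡0 : bad ≡ 0
      bad≡0 = clean⇒bad≡0 ((l₁ , agrees-if-full full) , kUses≡0 (noPrivates-if-full full) (K∉D⇒noKDominated noK))

    budget-oneClass : Budget
    budget-oneClass = byK (Finₚ.any? λ l → Finₚ.any? λ a → kv j l a ∈? D)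
      where
      byPartiality : (∀ l a → ¬ kv j l a ∈ D) → Dec (Σ (Fin A) λ a → ¬ lv j l₁ a ∈ D) → Budget
      byPartiality noK (yes (a , l∉D)) = budget-oneClass-partial noK a l∉D
      byPartiality noK (no full) = budget-oneClass-full noK λ a → decidable-stable (lv j l₁ a ∈? D) λ l∉D → full (a , l∉D)
      byK : Dec (Σ (Fin (C r)) λ l → Σ (Fin A) λ a → kv j l a ∈ D) → Budget
      byK (yes (l₀ , a₀ , k∈D)) = budget-oneClass-K l₀ a₀ k∈D
      byK (no noK) = byPartiality (λ l a k∈D → noK (l , a , k∈D)) (Finₚ.any? λ a → ¬? (lv j l₁ a ∈? D))

  budget-w∉D : ∀ l₁ a₁ → lv j l₁ a₁ ∈ D → wIn ≡ false → Budget
  budget-w∉D l₁ a₁ l₁∈D w∉D = byClasses (Finₚ.any? λ l₂ → Finₚ.any? λ a₂ → (lv j l₂ a₂ ∈? D) ×-dec ¬? (l₁ Finₚ.≟ l₂))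
    where
    byClasses : Dec (Σ (Fin (C r)) λ l₂ → Σ (Fin A) λ a₂ → lv j l₂ a₂ ∈ D × l₁ ≢ l₂) → Budget
    byClasses (yes (l₂ , a₂ , l₂∈D , l₁≢l₂)) = budget-twoClasses l₁ a₁ l₂ a₂ l₁∈D l₂∈D l₁≢l₂ w∉D
    byClasses (no otherClass) = budget-oneClass l₁ a₁ l₁∈D sameClass w∉D
      where
      sameClass : ∀ l a → lv j l a ∈ D → l ≡ l₁
      sameClass l a l∈D = decidable-stable (l Finₚ.≟ l₁) λ l≢l₁ → otherClass (l , a , l∈D , l≢l₁ ∘ sym)

  gadget-budget : Budget
  gadget-budget = byHub (w j ∈? D)
    where
    byHub : Dec (w j ∈ D) → Budget
    byHub (yes w∈D) = budget-w∈D w∈D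
    byHub (no w∉D) = let (l₁ , a₁ , l₁∈D) = w∉D⇒L∈D w∉D in budget-w∉D l₁ a₁ l₁∈D (∉⇒inD-false w∉D)

-- Counting, and a satisfying assignment from a clean copy

combine-budgets : ∀ k s₁ s₂ e b p x y → k ≤ s₁ + s₂ → 6 * s₁ + e ≤ 3 * p + x → 2 * s₂ + p + b ≤ y →
                  e + 3 * b + 6 * k ≤ x + 3 * y
combine-budgets k s₁ s₂ e b p x y k≤ paths gadgets = +-cancelʳ-≤ (3 * p) _ _ (begin
    e + 3 * b + 6 * k + 3 * p                 ≤⟨ +-monoˡ-≤ (3 * p) (+-monoʳ-≤ (e + 3 * b) (*-monoʳ-≤ 6 k≤)) ⟩
    e + 3 * b + 6 * (s₁ + s₂) + 3 * p         ≡⟨ solve 6 (λ e b p s₁ s₂ y → e :+ con 3 :* b :+ con 6 :* (s₁ :+ s₂) :+ con 3 :* p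
                                                    := (con 6 :* s₁ :+ e) :+ con 3 :* (con 2 :* s₂ :+ p :+ b)) refl e b p s₁ s₂ y ⟩
    (6 * s₁ + e) + 3 * (2 * s₂ + p + b)       ≤⟨ +-mono-≤ paths (*-monoʳ-≤ 3 gadgets) ⟩
    (3 * p + x) + 3 * y                       ≡⟨ solve 3 (λ p x y → (con 3 :* p :+ x) :+ con 3 :* y := x :+ con 3 :* y :+ con 3 :* p) refl p x y ⟩
    x + 3 * y + 3 * p ∎)
  where open ≤-Reasoning

12n<F : ∀ n → 12 * n < Fof n
12n<F zero = s≤s z≤n
12n<F (suc k) = begin-strict
    12 * suc k                                  <⟨ m<m+n (12 * suc k) (s≤s z≤n) ⟩
    12 * suc k + (1 + (8 * k * k + 10 * k + 2)) ≡⟨ solve 1 (λ k → con 12 :* (con 1 :+ k) :+ (con 1 :+ (con 8 :* k :* k :+ con 10 :* k :+ con 2))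
                                                     := (con 2 :* (con 1 :+ k) :+ con 1) :* (con 4 :* (con 1 :+ k) :+ con 1)) refl k ⟩
    Fof (suc k) ∎
  where open ≤-Reasoning

all-false : ∀ {a b c d e f g h} → a ≡ false → b ≡ false → c ≡ false → d ≡ false →
            e ≡ false → f ≡ false → g ≡ false → h ≡ false → (a ∨ b ∨ c ∨ d ∨ e ∨ f ∨ g ∨ h) ≡ false
all-false refl refl refl refl refl refl refl refl = refl

∨-false : ∀ {a b} → (a ∨ b) ≡ false → a ≡ false × b ≡ false
∨-false {false} {false} _ = refl , refl

module Analysis {q n m : ℕ} (φ : CSP6 q n m) (D : List (Construction.V φ)) (UD : Construction.UpperDominating φ D) where
  open Membership φ D UD
  module G = Gadget φ D UD

  Fm : ℕ
  Fm = F * m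

  pathLength≡ : pathLength ≡ 6 + Fm * 4
  pathLength≡ = trans (cong (_+ 6) (trans (*-assoc 4 F m) (*-comm 4 Fm))) (+-comm (Fm * 4) 6)

  edgePos-outer : ∀ J o → J < Fm → o ≤ 3 → 3 ≤ 4 * J + o + 3 × 4 * J + o + 3 < 3 + Fm * 4
  edgePos-outer J o J<Fm o≤3 = m≤n+m 3 (4 * J + o) , (begin-strict
      4 * J + o + 3     ≡⟨ edgePos≡blockPos J o ⟩
      blockPos J o      <⟨ blockPos-< o 0 J<Fm o≤3 ⟩
      0 + 3 + Fm * 4 ∎)
    where open ≤-Reasoning

  module Path (i : Fin n) where
    open OnPath i public

    size : ℕ
    size = sumTo (6 + Fm * 4) (bit ∘ pathBit i)

    blockPrivates : ℕ → ℕ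
    blockPrivates J = sumTo 4 λ o → bit (kPrivateAt (blockPos J o))

    privates penalties : ℕ
    privates = sumTo Fm blockPrivates
    penalties = sumTo Fm λ J → penaltyAt (suc J)

    kPrivate-outside : ∀ t → t < pathLength → t < 3 ⊎ 3 + Fm * 4 ≤ t → kPrivateAt t ≡ false
    kPrivate-outside t t<len outside = Boolₚ.¬-not λ kp →
      kPrivate-sound i (fromℕ< t<len) (subst (λ x → kPrivateAt x ≡ true) (sym (Finₚ.toℕ-fromℕ< t<len)) kp)
        λ (j , l , a , nbr , _) → inBlock outside (Finₚ.toℕ-fromℕ< t<len) nbr
      where
      inBlock : ∀ {j l a i′ t′} → t < 3 ⊎ 3 + Fm * 4 ≤ t → toℕ t′ ≡ t → ¬ KNbr j l a (u i′ t′)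
      inBlock {j} {l} side t′≡t (path s _ o inPair t′≡)
        with edgePos-outer (toℕ j) o (Finₚ.toℕ<n j) (inPair≤3 (acc (j′ j) l s) o inPair) | side
      ... | 3≤ , _ | inj₁ t<3 = <⇒≱ t<3 (subst (3 ≤_) (trans (sym t′≡) t′≡t) 3≤)
      ... | _ , <end | inj₂ end≤ = <⇒≱ (subst (_< 3 + Fm * 4) (trans (sym t′≡) t′≡t) <end) end≤

    kPrivate-unoccupied : ∀ t → pathBit i t ≡ false → kPrivateAt t ≡ false
    kPrivate-unoccupied t t∉D rewrite t∉D = refl

    kPrivates-block : ∀ J → kPrivates (suc J) ≡ blockPrivates J
    kPrivates-block J = +-assoc-4 (b 0) (b 1) (b 2) (b 3)
      where
      b : ℕ → ℕ
      b o = bit (kPrivateAt (blockPos J o))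
      +-assoc-4 : ∀ a b c d → a + b + c + d ≡ a + (b + (c + (d + 0)))
      +-assoc-4 = solve 4 (λ a b c d → a :+ b :+ c :+ d := a :+ (b :+ (c :+ (d :+ con 0)))) refl

    private
      start< : ∀ t → t < 3 → t < pathLength
      start< t t<3 = ≤-trans t<3 (≤-trans (m≤m+n 3 3) (m≤n+m 6 (4 * F * m)))

      end< : ∀ o → o < 3 → blockPos Fm o < pathLength
      end< o o<3 = subst (blockPos Fm o <_) (sym pathLength≡) (+-monoˡ-< (Fm * 4) (+-monoˡ-< 3 o<3))

      end≤ : ∀ o → 3 + Fm * 4 ≤ blockPos Fm o
      end≤ o = +-monoˡ-≤ (Fm * 4) (m≤n+m 3 o)

      beyond : ∀ k → pathLength ≤ k + 6 + Fm * 4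
      beyond k = subst (_≤ k + 6 + Fm * 4) (sym pathLength≡) (+-monoˡ-≤ (Fm * 4) (m≤n+m 6 k))

      vanish : ∀ {a b c} → a ≡ false → b ≡ false → c ≡ false → bit a + bit b + bit c ≡ 0
      vanish refl refl refl = refl

    kPrivates-first : kPrivates 0 ≡ 0
    kPrivates-first = vanish (kPrivate-outside 0 (start< 0 (s≤s z≤n)) (inj₁ (s≤s z≤n)))
                             (kPrivate-outside 1 (start< 1 (s≤s (s≤s z≤n))) (inj₁ (s≤s (s≤s z≤n))))
                             (kPrivate-outside 2 (start< 2 (s≤s (s≤s (s≤s z≤n)))) (inj₁ (s≤s (s≤s (s≤s z≤n)))))

    kPrivates-last : kPrivates (suc Fm) ≡ 0
    kPrivates-last = trans (kPrivates-block Fm) (cong₂ _+_ (outside 0 (s≤s z≤n)) (cong₂ _+_ (outside 1 (s≤s (s≤s z≤n)))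
      (cong₂ _+_ (outside 2 (s≤s (s≤s (s≤s z≤n)))) (cong (λ b → bit b + 0) (kPrivate-unoccupied _ (pathBit-beyond i _ (beyond 0)))))))
      where
      outside : ∀ o → o < 3 → bit (kPrivateAt (blockPos Fm o)) ≡ 0
      outside o o<3 = cong bit (kPrivate-outside _ (end< o o<3) (inj₂ (end≤ o)))

    path-bound : 6 * size + penalties ≤ 3 * privates + 12 * (2 + Fm)
    path-bound = begin
      6 * size + penalties                           ≤⟨ +-monoʳ-≤ (6 * size) penalties≤ ⟩
      6 * size + sumTo (2 + Fm) penaltyAt            ≤⟨ padded-bound Fm (pathBit i) (λ k → pathBit-beyond i _ (beyond k)) ⟩
      3 * sumTo (2 + Fm) kPrivates + 12 * (2 + Fm)   ≡⟨ cong (λ x → 3 * x + 12 * (2 + Fm)) all-privates ⟩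
      3 * privates + 12 * (2 + Fm) ∎
      where
      open ≤-Reasoning
      penalties≤ : penalties ≤ sumTo (2 + Fm) penaltyAt
      penalties≤ = begin
        penalties                                     ≤⟨ m≤m+n penalties (penaltyAt (suc Fm)) ⟩
        penalties + penaltyAt (suc Fm)                ≡⟨ sumTo-last Fm (penaltyAt ∘ suc) ⟨
        sumTo (suc Fm) (penaltyAt ∘ suc)              ≤⟨ m≤n+m _ (penaltyAt 0) ⟩
        sumTo (2 + Fm) penaltyAt ∎
      all-privates : sumTo (2 + Fm) kPrivates ≡ privates
      all-privates = begin-equality
        kPrivates 0 + sumTo (suc Fm) (kPrivates ∘ suc)        ≡⟨ cong₂ _+_ kPrivates-first (sumTo-last Fm (kPrivates ∘ suc)) ⟩
        sumTo Fm (kPrivates ∘ suc) + kPrivates (suc Fm)      ≡⟨ cong₂ _+_ (sumTo-cong< Fm λ J _ → kPrivates-block J) kPrivates-last ⟩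
        privates + 0                                          ≡⟨ +-identityʳ privates ⟩
        privates ∎

  pathSizes gadgetSizes allPenalties allPrivates allBad : ℕ
  pathSizes = sum Path.size
  gadgetSizes = sum G.size
  allPenalties = sum Path.penalties
  allPrivates = sum Path.privates
  allBad = sum G.bad

  length≤sizes : length D ≤ pathSizes + gadgetSizes
  length≤sizes = ≤-trans (length≤count-members D (proj₁ UD)) (≤-reflexive by-part)
    where
    f : V → ℕ
    f = bit ∘ inD
    onPath : ∀ i → count f (pathVertices i) ≡ Path.size i
    onPath i = begin
      count f (pathVertices i)                     ≡⟨ count-concatFin f pathLength (λ t → u i t ∷ []) ⟩
      sum (λ t → f (u i t) + 0)                    ≡⟨ sum-cong-≗ (λ t → trans (+-identityʳ _) (cong bit (sym (pathBit-toℕ i t)))) ⟩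
      sumTo pathLength (bit ∘ pathBit i)           ≡⟨ cong (λ N → sumTo N (bit ∘ pathBit i)) pathLength≡ ⟩
      Path.size i ∎
      where open ≡-Reasoning
    onGadget : ∀ j → count f (gadgetVertices j) ≡ G.size j
    onGadget j = begin
      count f (gadgetVertices j)                   ≡⟨ count-++ f (concatFin _ λ l → concatFin A λ a → kv j l a ∷ lv j l a ∷ []) (w j ∷ []) ⟩
      count f (concatFin _ λ l → concatFin A λ a → kv j l a ∷ lv j l a ∷ []) + (f (w j) + 0)
        ≡⟨ cong₂ _+_ (count-concatFin f (C (j′ j)) λ l → concatFin A λ a → kv j l a ∷ lv j l a ∷ []) (+-identityʳ _) ⟩
      sum (λ l → count f (concatFin A λ a → kv j l a ∷ lv j l a ∷ [])) + f (w j)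
        ≡⟨ cong (_+ f (w j)) (sum-cong-≗ λ l → trans (count-concatFin f A λ a → kv j l a ∷ lv j l a ∷ []) (sum-cong-≗ λ a → cong (f (kv j l a) +_) (+-identityʳ _))) ⟩
      sum (λ l → sum λ a → f (kv j l a) + f (lv j l a)) + f (w j)
        ≡⟨ cong (_+ f (w j)) (trans (sum-cong-≗ λ l → ∑-distrib-+ (λ a → f (kv j l a)) (λ a → f (lv j l a))) (∑-distrib-+ (λ l → sum λ a → f (kv j l a)) (λ l → sum λ a → f (lv j l a)))) ⟩
      G.size j ∎
      where open ≡-Reasoning
    by-part : count f vertices ≡ pathSizes + gadgetSizes
    by-part = trans (count-++ f (concatFin n pathVertices) (concatFin Fm gadgetVertices))
      (cong₂ _+_ (trans (count-concatFin f n pathVertices) (sum-cong-≗ onPath))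
                 (trans (count-concatFin f Fm gadgetVertices) (sum-cong-≗ onGadget)))

  paths-bound : 6 * pathSizes + allPenalties ≤ 3 * allPrivates + 12 * (2 + Fm) * n
  paths-bound = begin
    6 * pathSizes + allPenalties                       ≡⟨ cong (_+ allPenalties) (*-distribˡ-sum 6 Path.size) ⟩
    sum (λ i → 6 * Path.size i) + allPenalties         ≡⟨ ∑-distrib-+ (λ i → 6 * Path.size i) Path.penalties ⟨
    sum (λ i → 6 * Path.size i + Path.penalties i)     ≤⟨ sum-mono Path.path-bound ⟩
    sum (λ i → 3 * Path.privates i + 12 * (2 + Fm))   ≡⟨ ∑-distrib-+ (λ i → 3 * Path.privates i) (λ _ → 12 * (2 + Fm)) ⟩
    sum (λ i → 3 * Path.privates i) + sum {n} (λ _ → 12 * (2 + Fm))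
      ≡⟨ cong₂ _+_ (sym (*-distribˡ-sum 3 Path.privates)) (trans (sum-const n (12 * (2 + Fm))) (*-comm n _)) ⟩
    3 * allPrivates + 12 * (2 + Fm) * n ∎
    where open ≤-Reasoning

  privates-by-gadget : allPrivates ≡ sum G.privates
  privates-by-gadget = ∑-comm (λ i (j : Fin Fm) → Path.blockPrivates i (toℕ j))

  gadgets-bound : 2 * gadgetSizes + allPrivates + allBad ≤ 2 * A * Fm
  gadgets-bound = begin
    2 * gadgetSizes + allPrivates + allBad
      ≡⟨ cong₂ (λ x y → x + y + allBad) (*-distribˡ-sum 2 G.size) privates-by-gadget ⟩
    sum (λ j → 2 * G.size j) + sum G.privates + allBad
      ≡⟨ cong (_+ allBad) (∑-distrib-+ (λ j → 2 * G.size j) G.privates) ⟨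
    sum (λ j → 2 * G.size j + G.privates j) + allBad
      ≡⟨ ∑-distrib-+ (λ j → 2 * G.size j + G.privates j) G.bad ⟨
    sum (λ j → 2 * G.size j + G.privates j + G.bad j)  ≤⟨ sum-mono G.gadget-budget ⟩
    sum {Fm} (λ _ → 2 * A)                               ≡⟨ trans (sum-const Fm (2 * A)) (*-comm Fm (2 * A)) ⟩
    2 * A * Fm ∎
    where open ≤-Reasoning

  badness : Fin Fm → ℕ
  badness j = G.bad j + sum λ i → Path.penaltyAt i (suc (toℕ j))

  badness-bound : kOf q n m ≤ length D → sum badness ≤ 12 * n
  badness-bound k≤ = begin
    sum badness                    ≡⟨ ∑-distrib-+ G.bad (λ j → sum λ i → Path.penaltyAt i (suc (toℕ j))) ⟩
    allBad + sum (λ (j : Fin Fm) → sum λ i → Path.penaltyAt i (suc (toℕ j)))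
      ≡⟨ cong (allBad +_) (∑-comm (λ (j : Fin Fm) i → Path.penaltyAt i (suc (toℕ j)))) ⟩
    allBad + allPenalties          ≡⟨ +-comm allBad allPenalties ⟩
    allPenalties + allBad          ≤⟨ +-monoʳ-≤ allPenalties (m≤n*m allBad 3) ⟩
    allPenalties + 3 * allBad      ≤⟨ +-cancelʳ-≤ (6 * kOf q n m) _ _ (begin
      allPenalties + 3 * allBad + 6 * kOf q n m
        ≤⟨ combine-budgets _ pathSizes gadgetSizes _ _ allPrivates _ _ (≤-trans k≤ length≤sizes) paths-bound gadgets-bound ⟩
      12 * (2 + Fm) * n + 3 * (2 * A * Fm)
        ≡⟨ solve 3 (λ Fm n q → con 12 :* (con 2 :+ Fm) :* n :+ con 3 :* (con 2 :* (con 4 :* q :+ con 2) :* Fm)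
                     := con 12 :* n :+ con 6 :* (Fm :* (con 2 :* n :+ (con 4 :* q :+ con 2)) :+ con 2 :* n)) refl Fm n q ⟩
      12 * n + 6 * kOf q n m ∎) ⟩
    12 * n ∎
    where open ≤-Reasoning

  blockOf : Fin n → ℕ → Block
  blockOf i J = pathBit i (blockPos J 0) , pathBit i (blockPos J 1) , pathBit i (blockPos J 2) , pathBit i (blockPos J 3)

  bitAt-blockOf : ∀ i J p → p ≤ 3 → bitAt (blockOf i J) p ≡ pathBit i (blockPos J p)
  bitAt-blockOf i J 0 _ = refl
  bitAt-blockOf i J 1 _ = refl
  bitAt-blockOf i J 2 _ = refl
  bitAt-blockOf i J 3 _ = refl
  bitAt-blockOf i J (suc (suc (suc (suc _)))) (s≤s (s≤s (s≤s ())))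

  Quiet : Fin n → ℕ → Set
  Quiet i J = ∀ o → o < 4 → Path.kPrivateAt i (blockPos J o) ≡ false × Path.kDominatedAt i (blockPos J o) ≡ false

  Good : ℕ → Set
  Good J = ∀ i → Path.penaltyAt i (suc J) ≡ 0 × Quiet i J

  module _ (i : Fin n) where
    open Path i

    quiet⇒¬usesK : ∀ J → Quiet i J →
      usesK (at (suc J) 6) (at (suc J) 7) (at (suc J) 8) (at (suc J) 9) (at (suc J) 10) (at (suc J) 11) (at (suc J) 12) (at (suc J) 13) ≡ false
    quiet⇒¬usesK J quiet =
      all-false (p 0 (s≤s z≤n)) (p 1 (s≤s (s≤s z≤n))) (p 2 (s≤s (s≤s (s≤s z≤n)))) (p 3 ≤-refl)
                (d 0 (s≤s z≤n)) (d 1 (s≤s (s≤s z≤n))) (d 2 (s≤s (s≤s (s≤s z≤n)))) (d 3 ≤-refl)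
      where
      p : ∀ o → o < 4 → kPrivateAt (blockPos J o) ≡ false
      p o o<4 = proj₁ (quiet o o<4)
      d : ∀ o → o < 4 → kDominatedAt (blockPos J o) ≡ false
      d o o<4 = proj₂ (quiet o o<4)

    penalty-zero : ∀ K → penaltyAt K ≡ 0 →
      usesK (at K 6) (at K 7) (at K 8) (at K 9) (at K 10) (at K 11) (at K 12) (at K 13) ≡ false →
      exactlyTwo (at K 8) (at K 9) (at K 10) (at K 11) ≡ true ×
      (usesK (at K 2) (at K 3) (at K 4) (at K 5) (at K 6) (at K 7) (at K 8) (at K 9) ≡ false →
       does ((at K 8 , at K 9 , at K 10 , at K 11) ≟ᴮ (at K 4 , at K 5 , at K 6 , at K 7)) ≡ true)
    penalty-zero K = penalty-free (usesK (at K 6) (at K 7) (at K 8) (at K 9) (at K 10) (at K 11) (at K 12) (at K 13))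
                                  (exactlyTwo (at K 8) (at K 9) (at K 10) (at K 11))
                                  (usesK (at K 2) (at K 3) (at K 4) (at K 5) (at K 6) (at K 7) (at K 8) (at K 9))
                                  (does ((at K 8 , at K 9 , at K 10 , at K 11) ≟ᴮ (at K 4 , at K 5 , at K 6 , at K 7)))

    two-in-block : ∀ J → penaltyAt (suc J) ≡ 0 → Quiet i J →
      exactlyTwo (pathBit i (blockPos J 0)) (pathBit i (blockPos J 1)) (pathBit i (blockPos J 2)) (pathBit i (blockPos J 3)) ≡ true
    two-in-block J pen quiet = proj₁ (penalty-zero (suc J) pen (quiet⇒¬usesK J quiet))

    same-block : ∀ J → penaltyAt (2 + J) ≡ 0 → Quiet i (suc J) → Quiet i J → blockOf i (suc J) ≡ blockOf i J
    same-block J pen quiet quiet′ =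
      does≡true (blockOf i (suc J) ≟ᴮ blockOf i J) (proj₂ (penalty-zero (2 + J) pen (quiet⇒¬usesK (suc J) quiet)) (quiet⇒¬usesK J quiet′))

  constant-blocks : ∀ base d → (∀ d′ → d′ ≤ d → Good (base + d′)) → ∀ i → blockOf i (base + d) ≡ blockOf i base
  constant-blocks base zero good i = cong (blockOf i) (+-identityʳ base)
  constant-blocks base (suc d) good i = begin
    blockOf i (base + suc d)    ≡⟨ cong (blockOf i) (+-suc base d) ⟩
    blockOf i (suc (base + d))  ≡⟨ same-block i (base + d) (proj₁ (good-next i)) (proj₂ (good-next i)) (proj₂ (good d (n≤1+n d) i)) ⟩
    blockOf i (base + d)        ≡⟨ constant-blocks base d (λ d′ d′≤d → good d′ (≤-trans d′≤d (n≤1+n d))) i ⟩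
    blockOf i base ∎
    where
    open ≡-Reasoning
    good-next : Good (suc (base + d))
    good-next = subst Good (+-suc base d) (good (suc d) ≤-refl)

  clean-copy : kOf q n m ≤ length D → Σ (Fin F) λ c → ∀ (r : Fin m) → badness (combine c r) ≡ 0
  clean-copy k≤ = let (c , copy-clean) = pigeonhole copyBadness few in c , sum≡0⇒term≡0 (λ (r : Fin m) → badness (combine c r)) copy-clean
    where
    copyBadness : Fin F → ℕ
    copyBadness c = sum λ (r : Fin m) → badness (combine c r)
    few : sum copyBadness < F
    few = ≤-<-trans (≤-trans (≤-reflexive (sym (sum-combine F m badness))) (badness-bound k≤)) (12n<F n)

  clean⇒good : ∀ j → badness j ≡ 0 → G.Clean j × Good (toℕ j)
  clean⇒good j b≡0 = clean , λ i → sum≡0⇒term≡0 _ penalties≡0 i , quiet i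
    where
    clean : G.Clean j
    clean = G.bad≡0⇒clean j (m+n≡0⇒m≡0 (G.bad j) b≡0)
    penalties≡0 : sum (λ i → Path.penaltyAt i (suc (toℕ j))) ≡ 0
    penalties≡0 = m+n≡0⇒n≡0 (G.bad j) b≡0
    usage : Fin n → ℕ → ℕ
    usage i o = bit (Path.kPrivateAt i (blockPos (toℕ j) o) ∨ Path.kDominatedAt i (blockPos (toℕ j) o))
    quiet : ∀ i → Quiet i (toℕ j)
    quiet i o o<4 = ∨-false (bit≡0⇒false (sumTo≡0⇒term≡0 4 (usage i) (sum≡0⇒term≡0 (λ i → sumTo 4 (usage i)) (proj₂ clean) i) o o<4))

  module CleanCopy (c : Fin F) (copy-clean : ∀ (r : Fin m) → badness (combine c r) ≡ 0) where

    base : ℕ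
    base = m * toℕ c

    good : ∀ (r : Fin m) → G.Clean (combine c r) × Good (toℕ (combine c r))
    good r = clean⇒good (combine c r) (copy-clean r)

    position : ∀ (r : Fin m) → toℕ (combine c r) ≡ base + toℕ r
    position r = Finₚ.toℕ-combine c r

    blocks : ∀ (r : Fin m) i → blockOf i (toℕ (combine c r)) ≡ blockOf i base
    blocks r i = trans (cong (blockOf i) (position r)) (constant-blocks base (toℕ r) good-before i)
      where
      good-before : ∀ d → d ≤ toℕ r → Good (base + d)
      good-before d d≤r = subst Good (trans (position (fromℕ< d<m)) (cong (base +_) (Finₚ.toℕ-fromℕ< d<m))) (proj₂ (good (fromℕ< d<m)))
        where
        d<m : d < m
        d<m = ≤-<-trans d≤r (Finₚ.toℕ<n r)

    x : Fin n → Fin 6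
    x i = decode (blockOf i base)

    Satisfied : Fin m → Set
    Satisfied r = Σ (Fin (C r)) λ l → ∀ s → x (scope r s) ≡ acc r l s

    satisfied-at-copy : ∀ (r : Fin m) → Satisfied (j′ (combine c r))
    satisfied-at-copy r = l , value l agrees (proj₂ (good r))
      where
      l : Fin (C (j′ (combine c r)))
      l = proj₁ (proj₁ (proj₁ (good r)))
      agrees : ∀ s → G.Agrees (combine c r) l s
      agrees = proj₂ (proj₁ (proj₁ (good r)))
      J : ℕ
      J = toℕ (combine c r)
      value : ∀ l → (∀ s → G.Agrees (combine c r) l s) → Good J → ∀ s → x (scope (j′ (combine c r)) s) ≡ acc (j′ (combine c r)) l s
      value l agrees good-paths s = begin
        decode (blockOf i base) ≡⟨ cong decode (blocks r i) ⟨
        decode (blockOf i J)    ≡⟨ decode-correct v _ _ _ _ (two-in-block i J (proj₁ (good-paths i)) (proj₂ (good-paths i)))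
                                     (outsideD (inj₁ refl) (proj₁ (agrees s))) (outsideD (inj₂ refl) (proj₂ (agrees s))) ⟩
        v ∎
        where
        open ≡-Reasoning
        i : Fin n
        i = scope (j′ (combine c r)) s
        v : Fin 6
        v = acc (j′ (combine c r)) l s
        outsideD : ∀ {p} → InPair v p → pathBit i (4 * J + p + 3) ≡ false → bitAt (blockOf i J) p ≡ false
        outsideD {p} inPair p∉D =
          trans (bitAt-blockOf i J p (inPair≤3 v p inPair)) (trans (cong (pathBit i) (sym (edgePos≡blockPos J p))) p∉D)

    satisfied : ∀ r → Satisfied r
    satisfied r = subst Satisfied (cong proj₂ (Finₚ.remQuot-combine c r)) (satisfied-at-copy r)

  satisfiable : kOf q n m ≤ length D → Satisfiable φ
  satisfiable k≤ = let (c , copy-clean) = clean-copy k≤ in CleanCopy.x c copy-clean , CleanCopy.satisfied c copy-clean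

lemma5 : (q n m : ℕ) (φ : CSP6 q n m) (D : List (Construction.V φ)) →
         Construction.UpperDominating φ D → kOf q n m ≤ length D →
         Satisfiable φ
lemma5 q n m φ D upper k≤|D| = Analysis.satisfiable φ D upper k≤|D|
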